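{- Let $\mathcal{D}=(d_1,\dots,d_k)$ be a non-increasing sequence of integers with $d_i\ge 2$ for all $i$, and suppose at least one tree has degree sequence $\mathcal{D}$. Then the greedy tree with degree sequence $\mathcal{D}$ minimizes the Sombor index among all trees with degree sequence $\mathcal{D}$; that is, if $G$ denotes the greedy tree, then ${\rm SO}(G)\le {\rm SO}(T)$ for every tree $T$ with degree sequence $\mathcal{D}$.
   Context: For a graph $G=(V,E)$ with vertex degrees $d(v)$, the Sombor index is ${\rm SO}(G)=\sum_{uv\in E}\sqrt{d(u)^2+d(v)^2}$. A vertex of degree $1$ is called pendant. A tree $T$ has degree sequence $(d_1,\dots,d_k)$ (written in non-increasing order, pendant vertices omitted) if $T$ has exactly $k$ non-pendant vertices and their degrees, as a multiset, are $d_1,\dots,d_k$; the number of pendant vertices is then determined. The greedy tree with degree sequence $\mathcal{D}$ is the tree built as follows from the multiset of all vertex degrees ($d_1,\dots,d_k$ together with the required number of $1$'s): label the vertex of largest degree as the root $v$; label its neighbours $v_1,\dots,v_{d(v)}$ and assign them the largest available degrees so that $d(v_1)\ge d(v_2)\ge\dots\ge d(v_{d(v)})$; then label the neighbours of $v_1$ other than $v$ as $v_{1,1},\dots,v_{1,d(v_1)-1}$, assigning them the largest remaining degrees with $d(v_{1,1})\ge\dots\ge d(v_{1,d(v_1)-1})$, then do the same for $v_2,v_3,\dots,v_{d(v)}$; repeat this step for all newly labelled vertices, always next processing the labelled vertex of largest degree whose neighbours are not yet labelled. -}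

module Defs where

open import Data.Nat using (ℕ; zero; suc; _+_; _*_; _∸_; _^_; _≤_; _<_; _≤ᵇ_; _<ᵇ_; _≟_; _≤?_; _<?_; NonZero)
open import Data.Bool using (Bool; true; false; T; if_then_else_; _∧_; _∨_)
open import Data.Fin using (Fin; toℕ)
open import Data.List using (List; []; _∷_; [_]; _++_; length; map; filter; concatMap; allFin; upTo)
open import Data.Nat.ListAction using (sum)
open import Data.List.Relation.Unary.Unique.Propositional using (Unique)
open import Data.List.Relation.Unary.Linked using (Linked)
open import Data.List.Relation.Binary.Permutation.Propositional using (_↭_)
open import Data.Product using (Σ; _×_)
open import Relation.Nullary using (¬_; ¬?)
open import Relation.Binary.PropositionalEquality using (_≡_)

AdjMat : ℕ → Set
AdjMat N = Fin N → Fin N → Bool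

module _ {N : ℕ} (G : AdjMat N) where

  Adj : Fin N → Fin N → Set
  Adj u v = T (G u v)

  SymmetricAdj : Set
  SymmetricAdj = ∀ u v → G u v ≡ G v u

  IrreflexiveAdj : Set
  IrreflexiveAdj = ∀ u → G u u ≡ false

  data Walk : Fin N → Fin N → Set where
    here : ∀ {u} → Walk u u
    step : ∀ {u w v} → Adj u w → Walk w v → Walk u v

  Connected : Set
  Connected = ∀ u v → Walk u v

  HasCycle : Set
  HasCycle = Σ (Fin N) λ x → Σ (List (Fin N)) λ xs →
    (2 ≤ length xs) × Unique (x ∷ xs) × Linked Adj (x ∷ xs ++ [ x ])

  IsTree : Set
  IsTree = NonZero N × SymmetricAdj × IrreflexiveAdj × Connected × ¬ HasCycle

  deg : Fin N → ℕ
  deg v = sum (map (λ w → if G v w then 1 else 0) (allFin N))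

  nonPendantDegrees : List ℕ
  nonPendantDegrees = filter (λ d → ¬? (d ≟ 1)) (map deg (allFin N))

  HasDegSeq : List ℕ → Set
  HasDegSeq D = nonPendantDegrees ↭ D

  edgeVals : List ℕ
  edgeVals = concatMap (λ u → concatMap (λ w →
      if G u w ∧ (toℕ u <ᵇ toℕ w)
      then [ deg u * deg u + deg w * deg w ] else [])
    (allFin N)) (allFin N)

⌊√_⌋ : ℕ → ℕ
⌊√ m ⌋ = length (filter (λ r → r * r ≤? m) (map suc (upTo m)))

⌈√_⌉ : ℕ → ℕ
⌈√ m ⌉ = length (filter (λ r → r * r <? m) (upTo m))

-- Sombor index, SO(G) = Σ_{uv ∈ E} √(d(u)² + d(v)²), via dyadic
-- approximations:  SOlower n G / 2^n ≤ SO(G) ≤ SOupper n G / 2^n, and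
-- both approximations are within |E|/2^n of SO(G).  Hence
--   SO(G) ≤ SO(H)   ⇔   ∀ n → SOlower n G ≤ SOupper n H.

SOlower : ℕ → ∀ {N} → AdjMat N → ℕ
SOlower n G = sum (map (λ x → ⌊√ (4 ^ n * x) ⌋) (edgeVals G))

SOupper : ℕ → ∀ {N} → AdjMat N → ℕ
SOupper n G = sum (map (λ x → ⌈√ (4 ^ n * x) ⌉) (edgeVals G))

_SO≤_ : ∀ {N M} → AdjMat N → AdjMat M → Set
G SO≤ H = ∀ n → SOlower n G ≤ SOupper n H

-- Vertices are 0, 1, …, greedyN D - 1 in the labelling order of the
-- construction (root v = 0, then v₁,…,v_{d(v)}, then the children of
-- v₁, …).  Vertex i receives the i-th largest degree, degree i of the
-- full degree list D ++ (1,1,…,1).  Vertex 0 has d₀ children, every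
-- other vertex i has (its degree − 1) children, and the children of
-- each vertex are the next consecutive labels.

greedyN : List ℕ → ℕ
greedyN D = sum D ∸ length D + 2

fullDeg : List ℕ → ℕ → ℕ
fullDeg []      _       = 1
fullDeg (d ∷ D) zero    = d
fullDeg (d ∷ D) (suc i) = fullDeg D i

childCount : List ℕ → ℕ → ℕ
childCount D zero    = fullDeg D zero
childCount D (suc i) = fullDeg D (suc i) ∸ 1

firstChild : List ℕ → ℕ → ℕ
firstChild D zero    = 1
firstChild D (suc i) = firstChild D i + childCount D i

isChild : List ℕ → ℕ → ℕ → Bool
isChild D p c = (firstChild D p ≤ᵇ c) ∧ (c <ᵇ firstChild D p + childCount D p)

greedyTree : (D : List ℕ) → AdjMat (greedyN D)
greedyTree D u v = isChild D (toℕ u) (toℕ v) ∨ isChild D (toℕ v) (toℕ u)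

-- Root a tree at a vertex of maximum degree and orient every edge towards the root.
-- Each edge is then {v , parent v} for exactly one non-root vertex v, so
-- SO(T) = Σ_{v ≠ root} √(d(v)² + d(parent v)²).  The multiset of child degrees d(v)
-- is the degree multiset minus one copy of the root degree, and the multiset of
-- parent degrees d(parent v) contains the root degree once and every other degree d
-- with multiplicity d − 1, so both depend only on the degree sequence.  In the greedy
-- tree, listing the non-root vertices in labelling order makes both lists
-- non-increasing.  Since √(a² + b²) + √(c² + d²) ≤ √(a² + d²) + √(c² + b²) for
-- c ≤ a and d ≤ b, swapping partners shows that this sorted pairing minimises the sum.
module Submission where

open import Defs
open import Data.Nat
  using ( ℕ; zero; suc; pred; _+_; _*_; _∸_; _^_; _≤_; _<_; _≥_; z≤n; s≤s; _≤?_; _<?_; _≟_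
        ; _≤ᵇ_; _<ᵇ_; _≡ᵇ_; >-nonZero⁻¹)
open import Data.Nat.Properties
open import Data.Nat.ListAction using (sum)
open import Data.Nat.ListAction.Properties using (sum-++; sum-↭)
open import Data.Nat.Solver using (module +-*-Solver)
open +-*-Solver using (solve; _:+_; _:*_; _:=_; con)
open import Data.Bool using (Bool; true; false; T; if_then_else_; _∧_; _∨_; not)
open import Data.Bool.Properties
  using (∧-identityʳ; ∧-conicalˡ; ∧-conicalʳ; ∨-comm; ∨-zeroʳ; ¬-not; T-≡) renaming (_≟_ to _≟ᵇ_)
open import Data.Bool.ListAction using (any)
open import Data.Fin using (Fin; toℕ; fromℕ<) renaming (zero to fzero; suc to fsuc)
import Data.Fin.Properties as Fin
open import Data.List
  using ( List; []; _∷_; [_]; _++_; length; map; filter; concatMap; replicate; reverse; foldl; zip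
        ; upTo; applyUpTo; allFin; tabulate)
open import Data.List.Properties
  using ( map-upTo; map-++; map-tabulate; map-∘; tabulate-cong; filter-accept; filter-reject
        ; length-filter; length-applyUpTo; length-map; length-tabulate; length-++; length-replicate
        ; unfold-reverse; reverse-++; length-reverse; length-++-≤ʳ; ++-assoc)
open import Data.List.Membership.Propositional using (_∈_; _∉_)
open import Data.List.Membership.Propositional.Properties
  using (∈-map⁻; ∈-map⁺; ∈-∃++; ∈-++⁺ˡ; ∈-++⁺ʳ; ∈-++⁻; ∈-allFin)
open import Data.List.Relation.Unary.All as All using (All; []; _∷_)
import Data.List.Relation.Unary.All.Properties as All
open import Data.List.Relation.Unary.Any as Any using (Any; here; there)
open import Data.List.Relation.Unary.AllPairs using ([]; _∷_)
import Data.List.Relation.Unary.AllPairs.Properties as AllPairs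
open import Data.List.Relation.Unary.Linked as Linked using (Linked; []; [-]; _∷_)
import Data.List.Relation.Unary.Linked.Properties as Linked
open import Data.List.Relation.Unary.Unique.Propositional using (Unique)
import Data.List.Relation.Unary.Unique.Propositional.Properties as Unique
open import Data.List.Relation.Binary.Permutation.Propositional as ↭
  using (_↭_; ↭-refl; ↭-sym; ↭-trans; ↭-prep; ↭-swap; ↭-reflexive)
open import Data.List.Relation.Binary.Permutation.Propositional.Properties
  using (map⁺; ∈-resp-↭; drop-∷; shift; ++⁺ˡ; ++⁺ʳ; ∷↭∷ʳ; ↭-reverse; ↭-length; All-resp-↭)
open import Data.Product using (Σ; _×_; _,_; proj₁; proj₂)
open import Data.Sum using (_⊎_; inj₁; inj₂)
open import Data.Empty using (⊥; ⊥-elim)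
open import Function using (_∘_; id; flip)
open import Function.Bundles using (Equivalence)
open import Relation.Nullary using (¬_; yes; no; does; contradiction; ¬?)
open import Relation.Nullary.Decidable using (dec-true; dec-false)
open import Relation.Unary using (Decidable)
open import Relation.Binary using (DecidableEquality; Symmetric; tri<; tri≈; tri>)
open import Relation.Binary.PropositionalEquality hiding ([_])
open import Algebra.Properties.Semiring.Sum +-*-semiring
  using (sum-syntax; ∑-distrib-+; ∑-comm; sum-cong-≗; sum-replicate-zero; *-distribʳ-sum)
  renaming (sum to ∑)

-- count (applyUpTo (a +_) n) is the length of the initial run of P in a, a + 1, …, a + n − 1.
module DownwardClosedCount {P : ℕ → Set} (P? : Decidable P)
  (P-anti : ∀ {i j} → i ≤ j → P j → P i) where

  count : List ℕ → ℕ
  count xs = length (filter P? xs)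

  private
    shift≗ : ∀ (f : ℕ → ℕ) {a} → (∀ j → f j ≡ a + j) → ∀ j → f (suc j) ≡ suc a + j
    shift≗ f {a} f≗ j = trans (f≗ (suc j)) (+-suc a j)

    a≤ : ∀ a j → a + 0 ≤ a + j
    a≤ a j = +-monoʳ-≤ a z≤n

  count≡suc⇒P : ∀ a n c → count (applyUpTo (a +_) n) ≡ suc c → P (a + c)
  count≡suc⇒P a n = go n a (a +_) (λ _ → refl)
    where
    go : ∀ n a (f : ℕ → ℕ) → (∀ j → f j ≡ a + j) → ∀ c → count (applyUpTo f n) ≡ suc c → P (a + c)
    go (suc n) a f f≗ c eq with P? (f 0) | c
    ... | yes p | zero  = subst P (f≗ 0) p
    ... | yes _ | suc c = subst P (sym (+-suc a c)) (go n (suc a) (f ∘ suc) (shift≗ f f≗) c (suc-injective eq))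
    ... | no ¬p | c     = contradiction (P-anti (≤-trans (≤-reflexive (f≗ 0)) (≤-trans (a≤ a c) (n≤1+n _)))
                            (go n (suc a) (f ∘ suc) (shift≗ f f≗) c eq)) ¬p

  P⇒<count : ∀ a n j → P (a + j) → j < n → j < count (applyUpTo (a +_) n)
  P⇒<count a n = go n a (a +_) (λ _ → refl)
    where
    go : ∀ n a (f : ℕ → ℕ) → (∀ j → f j ≡ a + j) → ∀ j → P (a + j) → j < n → j < count (applyUpTo f n)
    go (suc n) a f f≗ j pj (s≤s j<n) with P? (f 0) | j
    ... | yes _ | zero  = s≤s z≤n
    ... | yes _ | suc j = s≤s (go n (suc a) (f ∘ suc) (shift≗ f f≗) j (subst P (+-suc a j) pj) j<n)
    ... | no ¬p | j     = contradiction (P-anti (≤-trans (≤-reflexive (f≗ 0)) (a≤ a j)) pj) ¬p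

-- Integer square roots

m*m≤n*n⇒m≤n : ∀ {m n} → m * m ≤ n * n → m ≤ n
m*m≤n*n⇒m≤n {m} {n} sq≤ with m ≤? n
... | yes m≤n = m≤n
... | no m≰n  = contradiction sq≤ (<⇒≱ (*-mono-< (≰⇒> m≰n) (≰⇒> m≰n)))

private
  module ⌊√⌋ (m : ℕ) = DownwardClosedCount (λ r → r * r ≤? m) (λ i≤j → ≤-trans (*-mono-≤ i≤j i≤j))
  module ⌈√⌉ (m : ℕ) = DownwardClosedCount (λ r → r * r <? m) (λ i≤j → <-≤-trans (s≤s (*-mono-≤ i≤j i≤j)))

  ⌊√⌋≡count : ∀ m → ⌊√ m ⌋ ≡ ⌊√⌋.count m (applyUpTo suc m)
  ⌊√⌋≡count m = cong (⌊√⌋.count m) (map-upTo suc m)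

⌊√⌋²≤ : ∀ m → ⌊√ m ⌋ * ⌊√ m ⌋ ≤ m
⌊√⌋²≤ m with ⌊√ m ⌋ in eq
... | zero  = z≤n
... | suc c = ⌊√⌋.count≡suc⇒P m 1 m c (trans (sym (⌊√⌋≡count m)) eq)

≤⌊√⌋ : ∀ m r → r * r ≤ m → r ≤ ⌊√ m ⌋
≤⌊√⌋ m zero    _  = z≤n
≤⌊√⌋ m (suc r) r² = subst (suc r ≤_) (sym (⌊√⌋≡count m))
  (⌊√⌋.P⇒<count m 1 m r r² (≤-trans (m≤m*n (suc r) (suc r)) r²))

≤⌈√⌉² : ∀ m → m ≤ ⌈√ m ⌉ * ⌈√ m ⌉
≤⌈√⌉² m with m ≤? ⌈√ m ⌉ * ⌈√ m ⌉ | ⌈√ m ⌉ <? m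
... | yes m≤ | _ = m≤
... | no m≰ | yes √<m = contradiction (⌈√⌉.P⇒<count m 0 m ⌈√ m ⌉ (≰⇒> m≰) √<m) (<-irrefl refl)
... | no m≰ | no √≮m = contradiction (≤-trans (≮⇒≥ √≮m) (n≤n*n ⌈√ m ⌉)) m≰
  where
  n≤n*n : ∀ n → n ≤ n * n
  n≤n*n zero    = z≤n
  n≤n*n (suc n) = m≤m*n (suc n) (suc n)

⌈√⌉≤ : ∀ m r → m ≤ r * r → ⌈√ m ⌉ ≤ r
⌈√⌉≤ m r m≤r² with ⌈√ m ⌉ in eq
... | zero  = z≤n
... | suc c = ≰⇒> λ r≤c → <⇒≱ (⌈√⌉.count≡suc⇒P m 0 m c eq) (≤-trans m≤r² (*-mono-≤ r≤c r≤c))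

⌊√⌋≤⌈√⌉ : ∀ m → ⌊√ m ⌋ ≤ ⌈√ m ⌉
⌊√⌋≤⌈√⌉ m = m*m≤n*n⇒m≤n (≤-trans (⌊√⌋²≤ m) (≤⌈√⌉² m))

⌈√⌉≤1+⌊√⌋ : ∀ m → ⌈√ m ⌉ ≤ suc ⌊√ m ⌋
⌈√⌉≤1+⌊√⌋ m = ⌈√⌉≤ m (suc ⌊√ m ⌋)
  (≮⇒≥ λ sq<m → <-irrefl refl (≤⌊√⌋ m (suc ⌊√ m ⌋) (<⇒≤ sq<m)))

2^n*2^n≡4^n : ∀ n → 2 ^ n * 2 ^ n ≡ 4 ^ n
2^n*2^n≡4^n zero    = refl
2^n*2^n≡4^n (suc n) = trans
  (solve 1 (λ x → (con 2 :* x) :* (con 2 :* x) := con 4 :* (x :* x)) refl (2 ^ n))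
  (cong (4 *_) (2^n*2^n≡4^n n))

private
  [2^n*a]²≡4^n*a² : ∀ n a → (2 ^ n * a) * (2 ^ n * a) ≡ 4 ^ n * (a * a)
  [2^n*a]²≡4^n*a² n a = trans
    (solve 2 (λ p a → (p :* a) :* (p :* a) := (p :* p) :* (a :* a)) refl (2 ^ n) a)
    (cong (_* (a * a)) (2^n*2^n≡4^n n))

2^n*⌊√⌋≤⌊√4^n*⌋ : ∀ n x → 2 ^ n * ⌊√ x ⌋ ≤ ⌊√ (4 ^ n * x) ⌋
2^n*⌊√⌋≤⌊√4^n*⌋ n x = ≤⌊√⌋ (4 ^ n * x) (2 ^ n * ⌊√ x ⌋)
  (subst (_≤ 4 ^ n * x) (sym ([2^n*a]²≡4^n*a² n ⌊√ x ⌋)) (*-monoʳ-≤ (4 ^ n) (⌊√⌋²≤ x)))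

⌈√4^n*⌉≤2^n*⌈√⌉ : ∀ n x → ⌈√ (4 ^ n * x) ⌉ ≤ 2 ^ n * ⌈√ x ⌉
⌈√4^n*⌉≤2^n*⌈√⌉ n x = ⌈√⌉≤ (4 ^ n * x) (2 ^ n * ⌈√ x ⌉)
  (subst (4 ^ n * x ≤_) (sym ([2^n*a]²≡4^n*a² n ⌈√ x ⌉)) (*-monoʳ-≤ (4 ^ n) (≤⌈√⌉² x)))

-- Comparing sums of square roots

lowerΣ√ upperΣ√ : ℕ → List ℕ → ℕ
lowerΣ√ n xs = sum (map (λ x → ⌊√ (4 ^ n * x) ⌋) xs)
upperΣ√ n xs = sum (map (λ x → ⌈√ (4 ^ n * x) ⌉) xs)

-- xs ≼√ ys says that Σ_{x ∈ xs} √x ≤ Σ_{y ∈ ys} √y, in the dyadic form of _SO≤_.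
infix 4 _≼√_
record _≼√_ (xs ys : List ℕ) : Set where
  constructor mk≼√
  field approx : ∀ n → lowerΣ√ n xs ≤ upperΣ√ n ys
open _≼√_ public

private
  4^[m+n]*x : ∀ m n x → 4 ^ (m + n) * x ≡ 4 ^ m * (4 ^ n * x)
  4^[m+n]*x m n x = trans (cong (_* x) (^-distribˡ-+-* 4 m n)) (*-assoc (4 ^ m) (4 ^ n) x)

lowerΣ√-refine : ∀ m n xs → 2 ^ m * lowerΣ√ n xs ≤ lowerΣ√ (m + n) xs
lowerΣ√-refine m n []       = ≤-reflexive (*-zeroʳ (2 ^ m))
lowerΣ√-refine m n (x ∷ xs) = begin
  2 ^ m * (⌊√ (4 ^ n * x) ⌋ + lowerΣ√ n xs)
    ≡⟨ *-distribˡ-+ (2 ^ m) _ _ ⟩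
  2 ^ m * ⌊√ (4 ^ n * x) ⌋ + 2 ^ m * lowerΣ√ n xs
    ≤⟨ +-mono-≤ (2^n*⌊√⌋≤⌊√4^n*⌋ m (4 ^ n * x)) (lowerΣ√-refine m n xs) ⟩
  ⌊√ (4 ^ m * (4 ^ n * x)) ⌋ + lowerΣ√ (m + n) xs
    ≡⟨ cong (λ y → ⌊√ y ⌋ + lowerΣ√ (m + n) xs) (sym (4^[m+n]*x m n x)) ⟩
  ⌊√ (4 ^ (m + n) * x) ⌋ + lowerΣ√ (m + n) xs ∎
  where open ≤-Reasoning

upperΣ√-refine : ∀ m n xs → upperΣ√ (m + n) xs ≤ 2 ^ m * upperΣ√ n xs
upperΣ√-refine m n []       = z≤n
upperΣ√-refine m n (x ∷ xs) = begin
  ⌈√ (4 ^ (m + n) * x) ⌉ + upperΣ√ (m + n) xs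
    ≡⟨ cong (λ y → ⌈√ y ⌉ + upperΣ√ (m + n) xs) (4^[m+n]*x m n x) ⟩
  ⌈√ (4 ^ m * (4 ^ n * x)) ⌉ + upperΣ√ (m + n) xs
    ≤⟨ +-mono-≤ (⌈√4^n*⌉≤2^n*⌈√⌉ m (4 ^ n * x)) (upperΣ√-refine m n xs) ⟩
  2 ^ m * ⌈√ (4 ^ n * x) ⌉ + 2 ^ m * upperΣ√ n xs
    ≡⟨ *-distribˡ-+ (2 ^ m) _ _ ⟨
  2 ^ m * (⌈√ (4 ^ n * x) ⌉ + upperΣ√ n xs) ∎
  where open ≤-Reasoning

upperΣ√≤lowerΣ√+length : ∀ n xs → upperΣ√ n xs ≤ lowerΣ√ n xs + length xs
upperΣ√≤lowerΣ√+length n []       = z≤n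
upperΣ√≤lowerΣ√+length n (x ∷ xs) = begin
  ⌈√ (4 ^ n * x) ⌉ + upperΣ√ n xs
    ≤⟨ +-mono-≤ (⌈√⌉≤1+⌊√⌋ (4 ^ n * x)) (upperΣ√≤lowerΣ√+length n xs) ⟩
  suc ⌊√ (4 ^ n * x) ⌋ + (lowerΣ√ n xs + length xs)
    ≡⟨ solve 3 (λ a b c → (con 1 :+ a) :+ (b :+ c) := (a :+ b) :+ (con 1 :+ c)) refl
         ⌊√ (4 ^ n * x) ⌋ (lowerΣ√ n xs) (length xs) ⟩
  (⌊√ (4 ^ n * x) ⌋ + lowerΣ√ n xs) + suc (length xs) ∎
  where open ≤-Reasoning

lowerΣ√≤upperΣ√ : ∀ n xs → lowerΣ√ n xs ≤ upperΣ√ n xs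
lowerΣ√≤upperΣ√ n []       = z≤n
lowerΣ√≤upperΣ√ n (x ∷ xs) = +-mono-≤ (⌊√⌋≤⌈√⌉ (4 ^ n * x)) (lowerΣ√≤upperΣ√ n xs)

≼√-refl : ∀ xs → xs ≼√ xs
≼√-refl xs = mk≼√ λ n → lowerΣ√≤upperΣ√ n xs

n<2^n : ∀ n → n < 2 ^ n
n<2^n zero    = s≤s z≤n
n<2^n (suc n) = ≤-trans (s≤s (n<2^n n))
  (subst (_≤ 2 ^ n + (2 ^ n + 0)) (+-comm (2 ^ n) 1)
    (+-monoʳ-≤ (2 ^ n) (≤-trans (m^n>0 2 n) (m≤m+n (2 ^ n) 0))))

≤-from-scaled : ∀ k a b e → k * a ≤ k * b + e → e < k → a ≤ b
≤-from-scaled k a b e ka≤kb+e e<k with a ≤? b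
... | yes a≤b = a≤b
... | no a≰b  = contradiction (+-cancelˡ-≤ (k * b) k e (begin
  k * b + k   ≡⟨ +-comm (k * b) k ⟩
  k + k * b   ≡⟨ *-suc k b ⟨
  k * suc b   ≤⟨ *-monoʳ-≤ k (≰⇒> a≰b) ⟩
  k * a       ≤⟨ ka≤kb+e ⟩
  k * b + e   ∎)) (<⇒≱ e<k)
  where open ≤-Reasoning

-- Comparing ys against itself costs an error of one per element of ys; it
-- is absorbed by working with length ys more binary digits of precision.
≼√-trans : ∀ {xs ys zs} → xs ≼√ ys → ys ≼√ zs → xs ≼√ zs
≼√-trans {xs} {ys} {zs} (mk≼√ xs≼ys) (mk≼√ ys≼zs) =
  mk≼√ λ n → ≤-from-scaled (2 ^ m) (lowerΣ√ n xs) (upperΣ√ n zs) m (scaled n) (n<2^n m)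
  where
  m = length ys
  open ≤-Reasoning
  scaled : ∀ n → 2 ^ m * lowerΣ√ n xs ≤ 2 ^ m * upperΣ√ n zs + m
  scaled n = begin
    2 ^ m * lowerΣ√ n xs       ≤⟨ lowerΣ√-refine m n xs ⟩
    lowerΣ√ (m + n) xs         ≤⟨ xs≼ys (m + n) ⟩
    upperΣ√ (m + n) ys         ≤⟨ upperΣ√≤lowerΣ√+length (m + n) ys ⟩
    lowerΣ√ (m + n) ys + m     ≤⟨ +-monoˡ-≤ m (ys≼zs (m + n)) ⟩
    upperΣ√ (m + n) zs + m     ≤⟨ +-monoˡ-≤ m (upperΣ√-refine m n zs) ⟩
    2 ^ m * upperΣ√ n zs + m   ∎

≼√-++ : ∀ {xs xs′ ys ys′} → xs ≼√ xs′ → ys ≼√ ys′ → xs ++ ys ≼√ xs′ ++ ys′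
≼√-++ {xs} {xs′} {ys} {ys′} (mk≼√ xs≼) (mk≼√ ys≼) = mk≼√ λ n →
  subst₂ _≤_ (sym (sum-map-++ xs ys)) (sym (sum-map-++ xs′ ys′)) (+-mono-≤ (xs≼ n) (ys≼ n))
  where
  sum-map-++ : ∀ {f : ℕ → ℕ} as bs → sum (map f (as ++ bs)) ≡ sum (map f as) + sum (map f bs)
  sum-map-++ {f} as bs = trans (cong sum (map-++ f as bs)) (sum-++ (map f as) (map f bs))

≼√-resp-↭ : ∀ {xs xs′ ys ys′} → xs ↭ xs′ → ys ↭ ys′ → xs′ ≼√ ys′ → xs ≼√ ys
≼√-resp-↭ xs↭ ys↭ (mk≼√ xs′≼ys′) = mk≼√ λ n →
  subst₂ _≤_ (sum-↭ (map⁺ _ (↭-sym xs↭))) (sum-↭ (map⁺ _ (↭-sym ys↭))) (xs′≼ys′ n)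

-- (√x₁ + √x₂)² = (x₁ + x₂) + 2√(x₁x₂), so equal sums and a larger product give larger roots.
⌊√⌋+⌊√⌋≤⌈√⌉+⌈√⌉ : ∀ x₁ x₂ y₁ y₂ → x₁ + x₂ ≡ y₁ + y₂ → x₁ * x₂ ≤ y₁ * y₂ →
                  ⌊√ x₁ ⌋ + ⌊√ x₂ ⌋ ≤ ⌈√ y₁ ⌉ + ⌈√ y₂ ⌉
⌊√⌋+⌊√⌋≤⌈√⌉+⌈√⌉ x₁ x₂ y₁ y₂ x₁+x₂≡ x₁x₂≤ = m*m≤n*n⇒m≤n (begin
  (p + q) * (p + q)                ≡⟨ [a+b]² p q ⟩
  (p * p + q * q) + 2 * (p * q)    ≤⟨ +-mono-≤ (+-mono-≤ (⌊√⌋²≤ x₁) (⌊√⌋²≤ x₂)) (*-monoʳ-≤ 2 pq≤rs) ⟩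
  (x₁ + x₂) + 2 * (r * s)          ≡⟨ cong (_+ 2 * (r * s)) x₁+x₂≡ ⟩
  (y₁ + y₂) + 2 * (r * s)          ≤⟨ +-monoˡ-≤ (2 * (r * s)) (+-mono-≤ (≤⌈√⌉² y₁) (≤⌈√⌉² y₂)) ⟩
  (r * r + s * s) + 2 * (r * s)    ≡⟨ [a+b]² r s ⟨
  (r + s) * (r + s)                ∎)
  where
  open ≤-Reasoning
  p = ⌊√ x₁ ⌋
  q = ⌊√ x₂ ⌋
  r = ⌈√ y₁ ⌉
  s = ⌈√ y₂ ⌉
  [ab]² : ∀ a b → (a * b) * (a * b) ≡ (a * a) * (b * b)
  [ab]² = solve 2 (λ a b → (a :* b) :* (a :* b) := (a :* a) :* (b :* b)) refl
  [a+b]² : ∀ a b → (a + b) * (a + b) ≡ (a * a + b * b) + 2 * (a * b)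
  [a+b]² = solve 2 (λ a b → (a :+ b) :* (a :+ b) := (a :* a :+ b :* b) :+ con 2 :* (a :* b)) refl
  pq≤rs : p * q ≤ r * s
  pq≤rs = m*m≤n*n⇒m≤n (begin
    (p * q) * (p * q)   ≡⟨ [ab]² p q ⟩
    (p * p) * (q * q)   ≤⟨ *-mono-≤ (⌊√⌋²≤ x₁) (⌊√⌋²≤ x₂) ⟩
    x₁ * x₂             ≤⟨ x₁x₂≤ ⟩
    y₁ * y₂             ≤⟨ *-mono-≤ (≤⌈√⌉² y₁) (≤⌈√⌉² y₂) ⟩
    (r * r) * (s * s)   ≡⟨ [ab]² r s ⟨
    (r * s) * (r * s)   ∎)

≼√-pair : ∀ {x₁ x₂ y₁ y₂} → x₁ + x₂ ≡ y₁ + y₂ → x₁ * x₂ ≤ y₁ * y₂ →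
          x₁ ∷ x₂ ∷ [] ≼√ y₁ ∷ y₂ ∷ []
≼√-pair {x₁} {x₂} {y₁} {y₂} x₁+x₂≡ x₁x₂≤ = mk≼√ λ n →
  let k = 4 ^ n in
  subst₂ _≤_ (cong (⌊√ k * x₁ ⌋ +_) (sym (+-identityʳ _))) (cong (⌈√ k * y₁ ⌉ +_) (sym (+-identityʳ _)))
    (⌊√⌋+⌊√⌋≤⌈√⌉+⌈√⌉ (k * x₁) (k * x₂) (k * y₁) (k * y₂) (scaled-sum k) (scaled-product k))
  where
  scaled-sum : ∀ k → k * x₁ + k * x₂ ≡ k * y₁ + k * y₂
  scaled-sum k = trans (sym (*-distribˡ-+ k x₁ x₂)) (trans (cong (k *_) x₁+x₂≡) (*-distribˡ-+ k y₁ y₂))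
  [ka][kb] : ∀ k a b → (k * a) * (k * b) ≡ (k * k) * (a * b)
  [ka][kb] = solve 3 (λ k a b → (k :* a) :* (k :* b) := (k :* k) :* (a :* b)) refl
  scaled-product : ∀ k → (k * x₁) * (k * x₂) ≤ (k * y₁) * (k * y₂)
  scaled-product k = subst₂ _≤_ (sym ([ka][kb] k x₁ x₂)) (sym ([ka][kb] k y₁ y₂)) (*-monoʳ-≤ (k * k) x₁x₂≤)

sqNorm : ℕ × ℕ → ℕ
sqNorm (a , b) = a * a + b * b

-- (a² + d²)(c² + b²) = (a² + b²)(c² + d²) + (a² − c²)(b² − d²).
sqNorm-exchange : ∀ {a b c d} → c ≤ a → d ≤ b →
                  sqNorm (a , b) ∷ sqNorm (c , d) ∷ [] ≼√ sqNorm (a , d) ∷ sqNorm (c , b) ∷ []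
sqNorm-exchange {c = c} {d} c≤a d≤b with m≤n⇒∃[o]m+o≡n c≤a | m≤n⇒∃[o]m+o≡n d≤b
... | e , refl | f , refl = ≼√-pair
  (solve 4 (λ c e d f → ((c :+ e) :* (c :+ e) :+ (d :+ f) :* (d :+ f)) :+ (c :* c :+ d :* d)
                    := ((c :+ e) :* (c :+ e) :+ d :* d) :+ (c :* c :+ (d :+ f) :* (d :+ f))) refl c e d f)
  (subst (sqNorm (c + e , d + f) * sqNorm (c , d) ≤_) (sym product-gap) (m≤m+n _ _))
  where
  product-gap : sqNorm (c + e , d) * sqNorm (c , d + f)
              ≡ sqNorm (c + e , d + f) * sqNorm (c , d) + (2 * c * e + e * e) * (2 * d * f + f * f)
  product-gap = solve 4 (λ c e d f →
      ((c :+ e) :* (c :+ e) :+ d :* d) :* (c :* c :+ (d :+ f) :* (d :+ f))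
    := ((c :+ e) :* (c :+ e) :+ (d :+ f) :* (d :+ f)) :* (c :* c :+ d :* d)
       :+ (con 2 :* c :* e :+ e :* e) :* (con 2 :* d :* f :+ f :* f)) refl c e d f

-- The rearrangement inequality for Σ √(a² + b²)

≤-head : ∀ {c cs x} → Linked _≥_ (c ∷ cs) → x ∈ c ∷ cs → x ≤ c
≤-head _          (here refl) = ≤-refl
≤-head (c≥ ∷ cs↘) (there x∈)  = ≤-trans (≤-head cs↘ x∈) c≥

∈⇒↭∷ : ∀ {A : Set} {y : A} {xs} → y ∈ xs → Σ (List A) λ ys → xs ↭ y ∷ ys
∈⇒↭∷ {y = y} y∈ with ∈-∃++ y∈
... | ys , zs , refl = ys ++ zs , shift y ys zs

module _ {c p : ℕ} {cs ps : List ℕ} (c↘ : Linked _≥_ (c ∷ cs)) (p↘ : Linked _≥_ (p ∷ ps)) where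

  pairMaxima : ∀ (L : List (ℕ × ℕ)) → map proj₁ L ↭ c ∷ cs → map proj₂ L ↭ p ∷ ps →
    Σ (List (ℕ × ℕ)) λ L′ → map proj₁ L′ ↭ cs × map proj₂ L′ ↭ ps ×
                            map sqNorm ((c , p) ∷ L′) ≼√ map sqNorm L
  pairMaxima L fst↭ snd↭ with ∈-map⁻ proj₁ (∈-resp-↭ (↭-sym fst↭) (here refl))
  ... | (_ , p₁) , cp₁∈L , refl with ∈⇒↭∷ cp₁∈L
  ...   | L₁ , L↭ with p₁ ≟ p
  ...     | yes refl = L₁ , drop-∷ (↭-trans (↭-sym (map⁺ proj₁ L↭)) fst↭)
                          , drop-∷ (↭-trans (↭-sym (map⁺ proj₂ L↭)) snd↭)
                          , ≼√-resp-↭ ↭-refl (map⁺ sqNorm L↭) (≼√-refl _)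
  ...     | no p₁≢p with ∈-resp-↭ (map⁺ proj₂ L↭) (∈-resp-↭ (↭-sym snd↭) (here refl))
  ...       | here p≡p₁ = contradiction (sym p≡p₁) p₁≢p
  ...       | there p∈L₁ with ∈-map⁻ proj₂ p∈L₁
  ...         | (c₂ , _) , c₂p∈L₁ , refl with ∈⇒↭∷ c₂p∈L₁
  ...           | L₂ , L₁↭ = (c₂ , p₁) ∷ L₂ , drop-∷ cs↭ , drop-∷ (↭-trans (↭-swap p p₁ ↭-refl) ps↭)
                    , ≼√-resp-↭ ↭-refl (map⁺ sqNorm L↭′)
                        (≼√-++ {xs′ = sqNorm (c , p₁) ∷ sqNorm (c₂ , p) ∷ []}
                          (sqNorm-exchange c₂≤c p₁≤p) (≼√-refl (map sqNorm L₂)))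
    where
    L↭′ : L ↭ (c , p₁) ∷ (c₂ , p) ∷ L₂
    L↭′ = ↭-trans L↭ (↭-prep _ L₁↭)
    cs↭ : c ∷ c₂ ∷ map proj₁ L₂ ↭ c ∷ cs
    cs↭ = ↭-trans (↭-sym (map⁺ proj₁ L↭′)) fst↭
    ps↭ : p₁ ∷ p ∷ map proj₂ L₂ ↭ p ∷ ps
    ps↭ = ↭-trans (↭-sym (map⁺ proj₂ L↭′)) snd↭
    c₂≤c : c₂ ≤ c
    c₂≤c = ≤-head c↘ (∈-resp-↭ cs↭ (there (here refl)))
    p₁≤p : p₁ ≤ p
    p₁≤p = ≤-head p↘ (∈-resp-↭ ps↭ (here refl))

sortedPairing-≼√ : ∀ {cs ps} (L : List (ℕ × ℕ)) → Linked _≥_ cs → Linked _≥_ ps →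
                   map proj₁ L ↭ cs → map proj₂ L ↭ ps → map sqNorm (zip cs ps) ≼√ map sqNorm L
sortedPairing-≼√ {[]}     {_}      L _  _  _   _   = mk≼√ λ _ → z≤n
sortedPairing-≼√ {_ ∷ _}  {[]}     L _  _  _   _   = mk≼√ λ _ → z≤n
sortedPairing-≼√ {c ∷ cs} {p ∷ ps} L c↘ p↘ fst↭ snd↭ with pairMaxima c↘ p↘ L fst↭ snd↭
... | L′ , fst↭′ , snd↭′ , L′≼L = ≼√-trans
  (≼√-++ (≼√-refl (sqNorm (c , p) ∷ []))
         (sortedPairing-≼√ L′ (Linked.tail c↘) (Linked.tail p↘) fst↭′ snd↭′))
  L′≼L

-- Sums over lists and over Fin n

sum-tabulate : ∀ {n} (F : Fin n → ℕ) → sum (tabulate F) ≡ ∑[ i < n ] F i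
sum-tabulate {zero}  F = refl
sum-tabulate {suc n} F = cong (F fzero +_) (sum-tabulate (F ∘ fsuc))

sum-map-allFin : ∀ {n} (F : Fin n → ℕ) → sum (map F (allFin n)) ≡ ∑[ i < n ] F i
sum-map-allFin F = trans (cong sum (map-tabulate id F)) (sum-tabulate F)

∑-const-1 : ∀ n → ∑[ i < n ] 1 ≡ n
∑-const-1 zero    = refl
∑-const-1 (suc n) = cong suc (∑-const-1 n)

sum-map-filter : ∀ {A : Set} {P : A → Set} (P? : Decidable P) (F : A → ℕ) xs →
                 sum (map F (filter P? xs)) ≡ sum (map (λ x → if does (P? x) then F x else 0) xs)
sum-map-filter P? F []       = refl
sum-map-filter P? F (x ∷ xs) with P? x
... | yes _ = cong (F x +_) (sum-map-filter P? F xs)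
... | no _  = sum-map-filter P? F xs

sum-map-concatMap : ∀ {A : Set} (g : ℕ → ℕ) (h : A → List ℕ) xs →
                    sum (map g (concatMap h xs)) ≡ sum (map (λ x → sum (map g (h x))) xs)
sum-map-concatMap g h []       = refl
sum-map-concatMap g h (x ∷ xs) = begin
  sum (map g (h x ++ concatMap h xs))             ≡⟨ cong sum (map-++ g (h x) (concatMap h xs)) ⟩
  sum (map g (h x) ++ map g (concatMap h xs))     ≡⟨ sum-++ (map g (h x)) _ ⟩
  sum (map g (h x)) + sum (map g (concatMap h xs)) ≡⟨ cong (sum (map g (h x)) +_) (sum-map-concatMap g h xs) ⟩
  sum (map g (h x)) + sum (map (λ x → sum (map g (h x))) xs) ∎
  where open ≡-Reasoning

if-else-0≡* : ∀ b x → (if b then x else 0) ≡ (if b then 1 else 0) * x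
if-else-0≡* true  x = sym (+-identityʳ x)
if-else-0≡* false x = refl

true≢false : true ≢ false
true≢false ()

_=ᵇ_ : ∀ {n} → Fin n → Fin n → Bool
i =ᵇ j = does (i Fin.≟ j)

=ᵇ≡true⇒≡ : ∀ {n} {i j : Fin n} → (i =ᵇ j) ≡ true → i ≡ j
=ᵇ≡true⇒≡ {i = i} {j} eq with i Fin.≟ j
... | yes i≡j = i≡j

∑-δ : ∀ {n} (a : Fin n) (X : Fin n → ℕ) → ∑[ i < n ] (if i =ᵇ a then X i else 0) ≡ X a
∑-δ {suc n} fzero    X = trans (cong (X fzero +_) (sum-replicate-zero n)) (+-identityʳ (X fzero))
∑-δ {suc n} (fsuc a) X = ∑-δ a (X ∘ fsuc)

<ᵇ-suc : ∀ a c → (a <ᵇ suc c) ≡ (a ≤ᵇ c)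
<ᵇ-suc zero    c = refl
<ᵇ-suc (suc a) c = refl

∑-<ᵇ : ∀ n b → b ≤ n → ∑[ i < n ] (if toℕ i <ᵇ b then 1 else 0) ≡ b
∑-<ᵇ n       zero    _         = sum-replicate-zero n
∑-<ᵇ (suc n) (suc b) (s≤s b≤n) = cong suc (∑-<ᵇ n b b≤n)

∑-interval : ∀ n a b → a ≤ b → b ≤ n →
             ∑[ i < n ] (if (a ≤ᵇ toℕ i) ∧ (toℕ i <ᵇ b) then 1 else 0) ≡ b ∸ a
∑-interval n       zero    b       _         b≤n       = ∑-<ᵇ n b b≤n
∑-interval (suc n) (suc a) (suc b) (s≤s a≤b) (s≤s b≤n) = trans
  (sum-cong-≗ {n} λ i → cong (λ x → if x ∧ (toℕ i <ᵇ b) then 1 else 0) (<ᵇ-suc a (toℕ i)))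
  (∑-interval n a b a≤b b≤n)

-- The count of x in a list is read off from sum ∘ map g with g the indicator of x.
sum-map-≡⇒↭ : ∀ (xs ys : List ℕ) → (∀ g → sum (map g xs) ≡ sum (map g ys)) → xs ↭ ys
sum-map-≡⇒↭ []       []       _     = ↭-refl
sum-map-≡⇒↭ []       (y ∷ ys) sums≡ with sums≡ (λ _ → 1)
... | ()
sum-map-≡⇒↭ (x ∷ xs) ys       sums≡ with ∈⇒↭∷ (x∈ ys (subst (0 <_) (sums≡ δx) (δx>0 xs)))
  where
  δx : ℕ → ℕ
  δx y = if does (y ≟ x) then 1 else 0
  δx>0 : ∀ xs → 0 < sum (map δx (x ∷ xs))
  δx>0 xs rewrite dec-true (x ≟ x) refl = s≤s z≤n
  x∈ : ∀ ys → 0 < sum (map δx ys) → x ∈ ys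
  x∈ (y ∷ ys) pos with y ≡ᵇ x in y≡ᵇx
  ... | true  = here (sym (≡ᵇ⇒≡ y x (subst T (sym y≡ᵇx) _)))
  ... | false = there (x∈ ys pos)
... | ys′ , ys↭ = ↭-trans (↭-prep x (sum-map-≡⇒↭ xs ys′ λ g →
  +-cancelˡ-≡ (g x) _ _ (trans (sums≡ g) (sum-↭ (map⁺ g ys↭))))) (↭-sym ys↭)

-- Simple graphs with every edge oriented towards a root

degrees : ∀ {M} → AdjMat M → List ℕ
degrees {M} G = map (deg G) (allFin M)

record ParentMap {M : ℕ} (G : AdjMat M) : Set where
  field
    symmetric   : SymmetricAdj G
    irreflexive : IrreflexiveAdj G
    root        : Fin M
    parent      : Fin M → Fin M
    parent-adj  : ∀ v → v ≢ root → G v (parent v) ≡ true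
    edge⇒parent : ∀ u w → G u w ≡ true → (u ≢ root × parent u ≡ w) ⊎ (w ≢ root × parent w ≡ u)
    parent-asym : ∀ u w → u ≢ root → w ≢ root → parent u ≡ w → parent w ≢ u

_<ᶠ_ : ∀ {n} → Fin n → Fin n → Bool
u <ᶠ w = toℕ u <ᵇ toℕ w

if-<ᶠ-split : ∀ {n} {u w : Fin n} → u ≢ w → ∀ X → (if u <ᶠ w then X else 0) + (if w <ᶠ u then X else 0) ≡ X
if-<ᶠ-split {u = u} {w} u≢w X with u <ᶠ w in u<w | w <ᶠ u in w<u
... | true  | true  = contradiction (<ᵇ⇒< (toℕ w) (toℕ u) (subst T (sym w<u) _))
                                    (<-asym (<ᵇ⇒< (toℕ u) (toℕ w) (subst T (sym u<w) _)))
... | true  | false = +-identityʳ X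
... | false | true  = refl
... | false | false with <-cmp (toℕ u) (toℕ w)
...   | tri< u<w′ _ _ = contradiction (<⇒<ᵇ u<w′) (subst T u<w)
...   | tri≈ _ u≡w _  = contradiction (Fin.toℕ-injective u≡w) u≢w
...   | tri> _ _ w<u′ = contradiction (<⇒<ᵇ w<u′) (subst T w<u)

sum-map-edgeVals : ∀ {M} (G : AdjMat M) (g : ℕ → ℕ) → sum (map g (edgeVals G))
  ≡ ∑[ u < M ] ∑[ w < M ] (if G u w ∧ (u <ᶠ w) then g (sqNorm (deg G u , deg G w)) else 0)
sum-map-edgeVals {M} G g = begin
  sum (map g (edgeVals G))
    ≡⟨ sum-map-concatMap g row (allFin M) ⟩
  sum (map (λ u → sum (map g (row u))) (allFin M))
    ≡⟨ sum-map-allFin (λ u → sum (map g (row u))) ⟩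
  ∑[ u < M ] sum (map g (row u))
    ≡⟨ sum-cong-≗ (λ u → trans (sum-map-concatMap g (entry u) (allFin M))
                        (trans (sum-map-allFin (λ w → sum (map g (entry u w))))
                               (sum-cong-≗ (λ w → sum-map-if (G u w ∧ (u <ᶠ w)))))) ⟩
  ∑[ u < M ] ∑[ w < M ] (if G u w ∧ (u <ᶠ w) then g (sqNorm (deg G u , deg G w)) else 0) ∎
  where
  open ≡-Reasoning
  entry : Fin M → Fin M → List ℕ
  entry u w = if G u w ∧ (u <ᶠ w) then [ sqNorm (deg G u , deg G w) ] else []
  row : Fin M → List ℕ
  row u = concatMap (entry u) (allFin M)
  sum-map-if : ∀ {y} b → sum (map g (if b then [ y ] else [])) ≡ (if b then g y else 0)
  sum-map-if true  = +-identityʳ _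
  sum-map-if false = refl

module ParentMapProperties {M : ℕ} {G : AdjMat M} (P : ParentMap G) where
  open ParentMap P

  nonRoot : List (Fin M)
  nonRoot = filter (λ v → ¬? (v Fin.≟ root)) (allFin M)

  childDegrees parentDegrees : List ℕ
  childDegrees  = map (deg G) nonRoot
  parentDegrees = map (deg G ∘ parent) nonRoot

  edgeDegrees : List (ℕ × ℕ)
  edgeDegrees = map (λ v → deg G v , deg G (parent v)) nonRoot

  sum-map-nonRoot : ∀ F → sum (map F nonRoot) ≡ ∑[ v < M ] (if not (v =ᵇ root) then F v else 0)
  sum-map-nonRoot F = trans (sum-map-filter (λ v → ¬? (v Fin.≟ root)) F (allFin M))
    (sum-map-allFin (λ v → if not (v =ᵇ root) then F v else 0))

  ∑-split-root : ∀ F → ∑[ v < M ] F v ≡ F root + ∑[ v < M ] (if not (v =ᵇ root) then F v else 0)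
  ∑-split-root F = begin
    ∑[ v < M ] F v
      ≡⟨ sum-cong-≗ (λ v → split (v =ᵇ root) (F v)) ⟩
    ∑[ v < M ] ((if v =ᵇ root then F v else 0) + (if not (v =ᵇ root) then F v else 0))
      ≡⟨ ∑-distrib-+ (λ v → if v =ᵇ root then F v else 0) (λ v → if not (v =ᵇ root) then F v else 0) ⟩
    ∑[ v < M ] (if v =ᵇ root then F v else 0) + ∑[ v < M ] (if not (v =ᵇ root) then F v else 0)
      ≡⟨ cong (_+ ∑[ v < M ] (if not (v =ᵇ root) then F v else 0)) (∑-δ root F) ⟩
    F root + ∑[ v < M ] (if not (v =ᵇ root) then F v else 0) ∎
    where
    open ≡-Reasoning
    split : ∀ b x → x ≡ (if b then x else 0) + (if not b then x else 0)
    split true  x = sym (+-identityʳ x)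
    split false x = refl

  childOf : Fin M → Fin M → Bool
  childOf v u = not (v =ᵇ root) ∧ (u =ᵇ parent v)

  childOf-intro : ∀ {v u} → v ≢ root → parent v ≡ u → childOf v u ≡ true
  childOf-intro {v} v≢r refl rewrite dec-false (v Fin.≟ root) v≢r | dec-true (parent v Fin.≟ parent v) refl = refl

  childOf-elim : ∀ {v u} → childOf v u ≡ true → v ≢ root × parent v ≡ u
  childOf-elim {v} {u} eq with v Fin.≟ root | u Fin.≟ parent v
  childOf-elim         () | yes _   | _
  childOf-elim         () | no _    | no _
  ...                     | no v≢r | yes u≡p = v≢r , sym u≡p

  childOf-false : ∀ {v u} → ¬ (v ≢ root × parent v ≡ u) → childOf v u ≡ false
  childOf-false {v} {u} ¬child with childOf v u in eq
  ... | true  = contradiction (childOf-elim eq) ¬child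
  ... | false = refl

  data EdgeView (u w : Fin M) : Set where
    child→parent : G u w ≡ true  → childOf u w ≡ true  → childOf w u ≡ false → EdgeView u w
    parent→child : G u w ≡ true  → childOf u w ≡ false → childOf w u ≡ true  → EdgeView u w
    nonEdge      : G u w ≡ false → childOf u w ≡ false → childOf w u ≡ false → EdgeView u w

  edgeView : ∀ u w → EdgeView u w
  edgeView u w with G u w in uw
  ... | true with edge⇒parent u w uw
  ...   | inj₁ (u≢r , pu≡w) = child→parent uw (childOf-intro u≢r pu≡w)
                                 (childOf-false λ (w≢r , pw≡u) → parent-asym u w u≢r w≢r pu≡w pw≡u)
  ...   | inj₂ (w≢r , pw≡u) = parent→child uw
                                 (childOf-false λ (u≢r , pu≡w) → parent-asym u w u≢r w≢r pu≡w pw≡u)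
                                 (childOf-intro w≢r pw≡u)
  edgeView u w | false = nonEdge uw
    (childOf-false λ (u≢r , pu≡w) → true≢false (trans (sym (adj u u≢r pu≡w)) uw))
    (childOf-false λ (w≢r , pw≡u) → true≢false (trans (sym (adj w w≢r pw≡u)) (trans (symmetric w u) uw)))
    where
    adj : ∀ v {x} → v ≢ root → parent v ≡ x → G v x ≡ true
    adj v v≢r refl = parent-adj v v≢r

  if-adj : ∀ u w b X → (if G u w ∧ b then X else 0)
                     ≡ (if childOf u w ∧ b then X else 0) + (if childOf w u ∧ b then X else 0)
  if-adj u w b X with edgeView u w
  ... | child→parent uw c₁ c₂ rewrite uw | c₁ | c₂ = sym (+-identityʳ _)
  ... | parent→child uw c₁ c₂ rewrite uw | c₁ | c₂ = refl
  ... | nonEdge      uw c₁ c₂ rewrite uw | c₁ | c₂ = refl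

  ∑-over-parent : ∀ v (X : Fin M → ℕ) →
                  ∑[ u < M ] (if childOf v u then X u else 0) ≡ (if not (v =ᵇ root) then X (parent v) else 0)
  ∑-over-parent v X with v =ᵇ root
  ... | true  = sum-replicate-zero M
  ... | false = ∑-δ (parent v) X

  children : Fin M → ℕ
  children u = ∑[ v < M ] (if childOf v u then 1 else 0)

  deg≡children : ∀ u → deg G u ≡ (if not (u =ᵇ root) then 1 else 0) + children u
  deg≡children u = begin
    deg G u
      ≡⟨ sum-map-allFin (λ w → if G u w then 1 else 0) ⟩
    ∑[ w < M ] (if G u w then 1 else 0)
      ≡⟨ sum-cong-≗ (λ w → trans (cong (λ b → if b then 1 else 0) (sym (∧-identityʳ (G u w)))) (if-adj u w true 1)) ⟩
    ∑[ w < M ] ((if childOf u w ∧ true then 1 else 0) + (if childOf w u ∧ true then 1 else 0))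
      ≡⟨ ∑-distrib-+ (λ w → if childOf u w ∧ true then 1 else 0) (λ w → if childOf w u ∧ true then 1 else 0) ⟩
    ∑[ w < M ] (if childOf u w ∧ true then 1 else 0) + ∑[ w < M ] (if childOf w u ∧ true then 1 else 0)
      ≡⟨ cong₂ _+_ (sum-cong-≗ λ w → cong (λ b → if b then 1 else 0) (∧-identityʳ (childOf u w)))
                   (sum-cong-≗ λ w → cong (λ b → if b then 1 else 0) (∧-identityʳ (childOf w u))) ⟩
    ∑[ w < M ] (if childOf u w then 1 else 0) + children u
      ≡⟨ cong (_+ children u) (∑-over-parent u (λ _ → 1)) ⟩
    (if not (u =ᵇ root) then 1 else 0) + children u ∎
    where open ≡-Reasoning

  sum-degrees : sum (degrees G) + 2 ≡ 2 * M
  sum-degrees = begin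
    sum (degrees G) + 2                                      ≡⟨ cong (_+ 2) (sum-map-allFin (deg G)) ⟩
    ∑[ u < M ] deg G u + 2                                   ≡⟨ cong (_+ 2) (sum-cong-≗ deg≡children) ⟩
    ∑[ u < M ] ([≢root] u + children u) + 2                  ≡⟨ cong (_+ 2) (∑-distrib-+ [≢root] children) ⟩
    (#nonRoot + ∑[ u < M ] children u) + 2                   ≡⟨ cong (λ c → (#nonRoot + c) + 2) children-total ⟩
    (#nonRoot + #nonRoot) + 2
      ≡⟨ solve 1 (λ n → (n :+ n) :+ con 2 := con 2 :* (con 1 :+ n)) refl #nonRoot ⟩
    2 * suc #nonRoot                                         ≡⟨ cong (2 *_) 1+#nonRoot ⟩
    2 * M ∎
    where
    open ≡-Reasoning
    [≢root] : Fin M → ℕ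
    [≢root] u = if not (u =ᵇ root) then 1 else 0
    #nonRoot = ∑[ u < M ] [≢root] u
    children-total : ∑[ u < M ] children u ≡ #nonRoot
    children-total = trans (∑-comm (λ u v → if childOf v u then 1 else 0)) (sum-cong-≗ λ v → ∑-over-parent v (λ _ → 1))
    1+#nonRoot : suc #nonRoot ≡ M
    1+#nonRoot = trans (sym (∑-split-root (λ _ → 1))) (∑-const-1 M)

  deg-root : deg G root ≡ children root
  deg-root = trans (deg≡children root)
    (cong (λ b → (if not b then 1 else 0) + children root) (dec-true (root Fin.≟ root) refl))

  deg-nonRoot : ∀ {u} → u ≢ root → deg G u ≡ suc (children u)
  deg-nonRoot {u} u≢r = trans (deg≡children u)
    (cong (λ b → (if not b then 1 else 0) + children u) (dec-false (u Fin.≟ root) u≢r))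

  children≡deg∸1 : 1 ≤ deg G root → ∀ u → children u ≡ (deg G u ∸ 1) + (if u =ᵇ root then 1 else 0)
  children≡deg∸1 root≥1 u with u Fin.≟ root
  ... | yes refl = sym (trans (m∸n+n≡m root≥1) deg-root)
  ... | no u≢r   = sym (trans (+-identityʳ _) (cong (_∸ 1) (deg-nonRoot u≢r)))

  degrees-↭ : degrees G ↭ deg G root ∷ childDegrees
  degrees-↭ = sum-map-≡⇒↭ _ _ λ g → begin
    sum (map g (degrees G))
      ≡⟨ cong sum (map-∘ (allFin M)) ⟨
    sum (map (g ∘ deg G) (allFin M))
      ≡⟨ sum-map-allFin (g ∘ deg G) ⟩
    ∑[ v < M ] g (deg G v)
      ≡⟨ ∑-split-root (g ∘ deg G) ⟩
    g (deg G root) + ∑[ v < M ] (if not (v =ᵇ root) then g (deg G v) else 0)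
      ≡⟨ cong (g (deg G root) +_) (sum-map-nonRoot (g ∘ deg G)) ⟨
    g (deg G root) + sum (map (g ∘ deg G) nonRoot)
      ≡⟨ cong (λ xs → g (deg G root) + sum xs) (map-∘ nonRoot) ⟩
    g (deg G root) + sum (map g childDegrees) ∎
    where open ≡-Reasoning

  -- A non-root vertex u is the parent of deg u − 1 vertices, the root of deg root.
  sum-map-parentDegrees : 1 ≤ deg G root → ∀ g →
    sum (map g parentDegrees) ≡ g (deg G root) + sum (map (λ d → (d ∸ 1) * g d) (degrees G))
  sum-map-parentDegrees root≥1 g = begin
    sum (map g parentDegrees)
      ≡⟨ cong sum (map-∘ nonRoot) ⟨
    sum (map (h ∘ parent) nonRoot)
      ≡⟨ sum-map-nonRoot (h ∘ parent) ⟩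
    ∑[ v < M ] (if not (v =ᵇ root) then h (parent v) else 0)
      ≡⟨ sum-cong-≗ (λ v → ∑-over-parent v h) ⟨
    ∑[ v < M ] ∑[ u < M ] (if childOf v u then h u else 0)
      ≡⟨ ∑-comm (λ v u → if childOf v u then h u else 0) ⟩
    ∑[ u < M ] ∑[ v < M ] (if childOf v u then h u else 0)
      ≡⟨ sum-cong-≗ (λ u → trans (sum-cong-≗ (λ v → if-else-0≡* (childOf v u) (h u)))
                                 (sym (*-distribʳ-sum (h u) (λ v → if childOf v u then 1 else 0)))) ⟩
    ∑[ u < M ] (children u * h u)
      ≡⟨ sum-cong-≗ (λ u → trans (cong (_* h u) (children≡deg∸1 root≥1 u)) (*-distribʳ-+ (h u) (deg G u ∸ 1) _)) ⟩
    ∑[ u < M ] ((deg G u ∸ 1) * h u + (if u =ᵇ root then 1 else 0) * h u)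
      ≡⟨ ∑-distrib-+ (λ u → (deg G u ∸ 1) * h u) (λ u → (if u =ᵇ root then 1 else 0) * h u) ⟩
    ∑[ u < M ] ((deg G u ∸ 1) * h u) + ∑[ u < M ] ((if u =ᵇ root then 1 else 0) * h u)
      ≡⟨ cong (∑[ u < M ] ((deg G u ∸ 1) * h u) +_)
              (trans (sum-cong-≗ (λ u → sym (if-else-0≡* (u =ᵇ root) (h u)))) (∑-δ root h)) ⟩
    ∑[ u < M ] ((deg G u ∸ 1) * h u) + h root
      ≡⟨ +-comm _ (h root) ⟩
    h root + ∑[ u < M ] ((deg G u ∸ 1) * h u)
      ≡⟨ cong (h root +_) (sum-map-allFin (λ u → (deg G u ∸ 1) * h u)) ⟨
    h root + sum (map (λ u → (deg G u ∸ 1) * h u) (allFin M))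
      ≡⟨ cong (λ xs → h root + sum xs) (map-∘ (allFin M)) ⟩
    g (deg G root) + sum (map (λ d → (d ∸ 1) * g d) (degrees G)) ∎
    where
    open ≡-Reasoning
    h : Fin M → ℕ
    h = g ∘ deg G

  -- Each edge is {v , parent v} for exactly one non-root v.
  ∑-edges : ∀ (X : Fin M → Fin M → ℕ) → (∀ u w → X u w ≡ X w u) →
            ∑[ u < M ] ∑[ w < M ] (if G u w ∧ (u <ᶠ w) then X u w else 0)
          ≡ ∑[ v < M ] (if not (v =ᵇ root) then X v (parent v) else 0)
  ∑-edges X X-sym = begin
    ∑[ u < M ] ∑[ w < M ] (if G u w ∧ (u <ᶠ w) then X u w else 0)
      ≡⟨ sum-cong-≗ (λ u → trans (sum-cong-≗ (λ w → if-adj u w (u <ᶠ w) (X u w)))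
                                 (∑-distrib-+ (λ w → up u w (u <ᶠ w)) (λ w → down u w (u <ᶠ w)))) ⟩
    ∑[ u < M ] (∑[ w < M ] up u w (u <ᶠ w) + ∑[ w < M ] down u w (u <ᶠ w))
      ≡⟨ ∑-distrib-+ (λ u → ∑[ w < M ] up u w (u <ᶠ w)) (λ u → ∑[ w < M ] down u w (u <ᶠ w)) ⟩
    ∑[ u < M ] ∑[ w < M ] up u w (u <ᶠ w) + ∑[ u < M ] ∑[ w < M ] down u w (u <ᶠ w)
      ≡⟨ cong (∑[ u < M ] ∑[ w < M ] up u w (u <ᶠ w) +_)
              (trans (∑-comm (λ u w → down u w (u <ᶠ w)))
                     (sum-cong-≗ λ w → sum-cong-≗ λ u → cong (if childOf w u ∧ (u <ᶠ w) then_else 0) (X-sym u w))) ⟩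
    ∑[ u < M ] ∑[ w < M ] up u w (u <ᶠ w) + ∑[ u < M ] ∑[ w < M ] up u w (w <ᶠ u)
      ≡⟨ ∑-distrib-+ (λ u → ∑[ w < M ] up u w (u <ᶠ w)) (λ u → ∑[ w < M ] up u w (w <ᶠ u)) ⟨
    ∑[ u < M ] (∑[ w < M ] up u w (u <ᶠ w) + ∑[ w < M ] up u w (w <ᶠ u))
      ≡⟨ sum-cong-≗ (λ u → trans (sym (∑-distrib-+ (λ w → up u w (u <ᶠ w)) (λ w → up u w (w <ᶠ u))))
                                 (sum-cong-≗ (λ w → both-orders u w))) ⟩
    ∑[ u < M ] ∑[ w < M ] (if childOf u w then X u w else 0)
      ≡⟨ sum-cong-≗ (λ u → ∑-over-parent u (X u)) ⟩
    ∑[ v < M ] (if not (v =ᵇ root) then X v (parent v) else 0) ∎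
    where
    open ≡-Reasoning
    up down : Fin M → Fin M → Bool → ℕ
    up   u w b = if childOf u w ∧ b then X u w else 0
    down u w b = if childOf w u ∧ b then X u w else 0
    both-orders : ∀ u w → up u w (u <ᶠ w) + up u w (w <ᶠ u) ≡ (if childOf u w then X u w else 0)
    both-orders u w with childOf u w in child
    ... | false = refl
    ... | true  = if-<ᶠ-split u≢w (X u w)
      where
      u≢w : u ≢ w
      u≢w refl with childOf-elim child
      ... | u≢r , pu≡u = contradiction
        (trans (sym (subst (λ x → G u x ≡ true) pu≡u (parent-adj u u≢r))) (irreflexive u)) λ ()

  edgeVals-↭ : edgeVals G ↭ map sqNorm edgeDegrees
  edgeVals-↭ = sum-map-≡⇒↭ _ _ λ g → begin
    sum (map g (edgeVals G))
      ≡⟨ sum-map-edgeVals G g ⟩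
    ∑[ u < M ] ∑[ w < M ] (if G u w ∧ (u <ᶠ w) then g (sqNorm (deg G u , deg G w)) else 0)
      ≡⟨ ∑-edges (λ u w → g (sqNorm (deg G u , deg G w)))
                 (λ u w → cong g (+-comm (deg G u * deg G u) (deg G w * deg G w))) ⟩
    ∑[ v < M ] (if not (v =ᵇ root) then g (sqNorm (deg G v , deg G (parent v))) else 0)
      ≡⟨ sum-map-nonRoot (g ∘ sqNorm ∘ λ v → deg G v , deg G (parent v)) ⟨
    sum (map (g ∘ sqNorm ∘ λ v → deg G v , deg G (parent v)) nonRoot)
      ≡⟨ cong sum (trans (map-∘ nonRoot) (cong (map g) (map-∘ nonRoot))) ⟩
    sum (map g (map sqNorm edgeDegrees)) ∎
    where open ≡-Reasoning

zip-map-map : ∀ {A B C : Set} (f : A → B) (g : A → C) xs → zip (map f xs) (map g xs) ≡ map (λ x → f x , g x) xs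
zip-map-map f g []       = refl
zip-map-map f g (x ∷ xs) = cong ((f x , g x) ∷_) (zip-map-map f g xs)

module _ {M N} {G : AdjMat M} {H : AdjMat N} (PG : ParentMap G) (PH : ParentMap H) where
  private
    module G = ParentMapProperties PG
    module H = ParentMapProperties PH
    rG = ParentMap.root PG
    rH = ParentMap.root PH

  sortedParentMap-≼√ : degrees G ↭ degrees H → deg G rG ≡ deg H rH → 1 ≤ deg G rG →
                       Linked _≥_ G.childDegrees → Linked _≥_ G.parentDegrees → edgeVals G ≼√ edgeVals H
  sortedParentMap-≼√ degs↭ root≡ root≥1 child↘ parent↘ = ≼√-resp-↭ G.edgeVals-↭ H.edgeVals-↭
    (subst (λ L → map sqNorm L ≼√ map sqNorm H.edgeDegrees) (zip-map-map (deg G) (deg G ∘ ParentMap.parent PG) G.nonRoot)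
      (sortedPairing-≼√ H.edgeDegrees child↘ parent↘ (subst (_↭ G.childDegrees) (map-∘ H.nonRoot) child↭)
                                                     (subst (_↭ G.parentDegrees) (map-∘ H.nonRoot) parent↭)))
    where
    child↭ : H.childDegrees ↭ G.childDegrees
    child↭ = drop-∷ (↭-trans (↭-sym H.degrees-↭)
                    (↭-trans (↭-sym degs↭) (subst (λ d → degrees G ↭ d ∷ G.childDegrees) root≡ G.degrees-↭)))
    parent↭ : H.parentDegrees ↭ G.parentDegrees
    parent↭ = sum-map-≡⇒↭ _ _ λ g → begin
      sum (map g H.parentDegrees)
        ≡⟨ H.sum-map-parentDegrees (subst (1 ≤_) root≡ root≥1) g ⟩
      g (deg H rH) + sum (map (λ d → (d ∸ 1) * g d) (degrees H))
        ≡⟨ cong₂ (λ r ds → g r + ds) (sym root≡) (sum-↭ (map⁺ (λ d → (d ∸ 1) * g d) (↭-sym degs↭))) ⟩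
      g (deg G rG) + sum (map (λ d → (d ∸ 1) * g d) (degrees G))
        ≡⟨ G.sum-map-parentDegrees root≥1 g ⟨
      sum (map g G.parentDegrees) ∎
      where open ≡-Reasoning

-- Trees

module _ {A : Set} where

  Unique-resp-↭ : ∀ {xs ys : List A} → xs ↭ ys → Unique xs → Unique ys
  Unique-resp-↭ ↭.refl         xs!                     = xs!
  Unique-resp-↭ (↭.prep x p)   (x∉ ∷ xs!)              = All-resp-↭ p x∉ ∷ Unique-resp-↭ p xs!
  Unique-resp-↭ (↭.swap x y p) ((x≢y ∷ x∉) ∷ y∉ ∷ xs!) =
    ((x≢y ∘ sym) ∷ All-resp-↭ p y∉) ∷ All-resp-↭ p x∉ ∷ Unique-resp-↭ p xs!
  Unique-resp-↭ (↭.trans p q)  xs!                     = Unique-resp-↭ q (Unique-resp-↭ p xs!)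

  Unique-++⁻ˡ : ∀ (xs : List A) {ys} → Unique (xs ++ ys) → Unique xs
  Unique-++⁻ˡ []       _           = []
  Unique-++⁻ˡ (x ∷ xs) (x∉ ∷ xs!) = All.++⁻ˡ xs x∉ ∷ Unique-++⁻ˡ xs xs!

  module _ {R : A → A → Set} where

    Linked-++⁻ˡ : ∀ (xs : List A) {ys} → Linked R (xs ++ ys) → Linked R xs
    Linked-++⁻ˡ []           _        = []
    Linked-++⁻ˡ (x ∷ [])     _        = [-]
    Linked-++⁻ˡ (x ∷ y ∷ xs) (r ∷ rs) = r ∷ Linked-++⁻ˡ (y ∷ xs) rs

    Linked-++-∷ : ∀ (xs : List A) {z ys} → Linked R (xs ++ [ z ]) → Linked R (z ∷ ys) → Linked R (xs ++ z ∷ ys)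
    Linked-++-∷ []           _        rs′ = rs′
    Linked-++-∷ (x ∷ [])     (r ∷ _)  rs′ = r ∷ rs′
    Linked-++-∷ (x ∷ y ∷ xs) (r ∷ rs) rs′ = r ∷ Linked-++-∷ (y ∷ xs) rs rs′

    Linked-reverse : Symmetric R → ∀ {xs} → Linked R xs → Linked R (reverse xs)
    Linked-reverse R-sym []            = []
    Linked-reverse R-sym {x ∷ xs} rs = go x [] xs [-] rs
      where
      go : ∀ x acc xs → Linked R (x ∷ acc) → Linked R (x ∷ xs) → Linked R (foldl (flip _∷_) (x ∷ acc) xs)
      go x acc []       racc _        = racc
      go x acc (y ∷ xs) racc (r ∷ rs) = go y (x ∷ acc) xs (R-sym r ∷ racc) rs

module _ {A : Set} (_≟_ : DecidableEquality A) {R : A → A → Set} (R-sym : Symmetric R) where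
  open import Data.List.Membership.DecPropositional _≟_ using (_∈?_)

  firstMember : ∀ (xs ys : List A) → Any (_∈ ys) xs →
    Σ (List A) λ α → Σ A λ z → Σ (List A) λ γ → (xs ≡ α ++ z ∷ γ) × (z ∈ ys) × All (_∉ ys) α
  firstMember (x ∷ xs) ys x∈ with x ∈? ys
  ... | yes x∈ys = [] , x , xs , refl , x∈ys , []
  ... | no x∉ys with x∈
  ...   | here x∈ys = contradiction x∈ys x∉ys
  ...   | there xs∈ with firstMember xs ys xs∈
  ...     | α , z , γ , refl , z∈ , α∉ = x ∷ α , z , γ , refl , z∈ , x∉ys ∷ α∉

  -- With z the first vertex of the path from w that lies on the path from u,
  -- w ⋯ z ⋯ u w is a cycle.
  meetingPaths⇒cycle : ∀ {u w} {us ws : List A} →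
    Unique (u ∷ us) → Unique (w ∷ ws) → Linked R (u ∷ us) → Linked R (w ∷ ws) →
    Any (_∈ u ∷ us) (w ∷ ws) → R u w → u ∉ w ∷ ws → w ∉ u ∷ us →
    Σ A λ x → Σ (List A) λ xs → (2 ≤ length xs) × Unique (x ∷ xs) × Linked R (x ∷ xs ++ [ x ])
  meetingPaths⇒cycle {u} {w} {us} {ws} us! ws! us↝ ws↝ meet uw u∉ w∉
    with firstMember (w ∷ ws) (u ∷ us) meet
  ... | [] , z , γ , refl , z∈ , _ = contradiction z∈ w∉
  ... | w′ ∷ α′ , z , γ , ws≡ , z∈ , α∉ with ∈-∃++ z∈
  ...   | [] , δ , refl = contradiction (subst (z ∈_) (sym ws≡) (∈-++⁺ʳ (w′ ∷ α′) (here refl))) u∉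
  ...   | u′ ∷ β′ , δ , us≡ with ws≡ | us≡
  ...     | refl | refl = w , α′ ++ z ∷ reverse β , length≥2 , unique , linked
    where
    α = w ∷ α′
    β = u ∷ β′
    length≥2 : 2 ≤ length (α′ ++ z ∷ reverse β)
    length≥2 = ≤-trans (s≤s (≤-trans (s≤s z≤n) (≤-reflexive (sym (length-reverse β)))))
                       (length-++-≤ʳ (z ∷ reverse β) {α′})
    βz! : Unique (β ++ [ z ])
    βz! = Unique-++⁻ˡ (β ++ [ z ]) (subst Unique (sym (++-assoc β [ z ] δ)) us!)
    disjoint : ∀ {v} → v ∈ α → v ∈ β ++ [ z ] → ⊥
    disjoint v∈α v∈βz = All.lookup α∉ v∈α (on-u-path v∈βz)
      where
      on-u-path : ∀ {v} → v ∈ β ++ [ z ] → v ∈ β ++ z ∷ δ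
      on-u-path v∈ with ∈-++⁻ β v∈
      ... | inj₁ v∈β         = ∈-++⁺ˡ v∈β
      ... | inj₂ (here refl) = ∈-++⁺ʳ β (here refl)
    unique : Unique (w ∷ α′ ++ z ∷ reverse β)
    unique = Unique-resp-↭ (++⁺ˡ α (↭-trans (↭-sym (∷↭∷ʳ z β)) (↭-prep z (↭-sym (↭-reverse β)))))
               (Unique.++⁺ (Unique-++⁻ˡ α ws!) βz! λ (v∈α , v∈βz) → disjoint v∈α v∈βz)
    αz↝ : Linked R (α ++ [ z ])
    αz↝ = Linked-++⁻ˡ (α ++ [ z ]) (subst (Linked R) (sym (++-assoc α [ z ] γ)) ws↝)
    zβw↝ : Linked R (z ∷ reverse β ++ [ w ])
    zβw↝ = subst (Linked R) (trans (unfold-reverse w (β ++ [ z ])) (cong (_++ [ w ]) (reverse-++ β [ z ])))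
             (Linked-reverse R-sym (R-sym uw ∷ Linked-++⁻ˡ (β ++ [ z ]) (subst (Linked R) (sym (++-assoc β [ z ] δ)) us↝)))
    linked : Linked R (w ∷ (α′ ++ z ∷ reverse β) ++ [ w ])
    linked = subst (λ xs → Linked R (w ∷ xs)) (sym (++-assoc α′ (z ∷ reverse β) [ w ])) (Linked-++-∷ α αz↝ zβw↝)

any-intro : ∀ {A : Set} (p : A → Bool) {x} xs → x ∈ xs → p x ≡ true → any p xs ≡ true
any-intro p (x ∷ xs) (here refl) px rewrite px = refl
any-intro p (y ∷ xs) (there x∈) px rewrite any-intro p xs x∈ px = ∨-zeroʳ (p y)

choose : ∀ {A : Set} → (A → Bool) → A → List A → A
choose p default []       = default
choose p default (x ∷ xs) with p x
... | true  = x
... | false = choose p default xs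

choose-sound : ∀ {A : Set} (p : A → Bool) default xs → any p xs ≡ true → p (choose p default xs) ≡ true
choose-sound p default (x ∷ xs) any-p with p x in px
... | true  = px
... | false = choose-sound p default xs any-p

module TreeParentMap {M : ℕ} {G : AdjMat M} (tree : IsTree G) (r : Fin M) where
  private
    symmetric   = proj₁ (proj₂ tree)
    irreflexive = proj₁ (proj₂ (proj₂ tree))
    connected   = proj₁ (proj₂ (proj₂ (proj₂ tree)))
    acyclic     = proj₂ (proj₂ (proj₂ (proj₂ tree)))

  reaches : ℕ → Fin M → Bool
  reaches zero    v = v =ᵇ r
  reaches (suc k) v = reaches k v ∨ any (λ w → G v w ∧ reaches k w) (allFin M)

  reaches-step : ∀ k {v w} → G v w ≡ true → reaches k w ≡ true → reaches (suc k) v ≡ true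
  reaches-step k {v} {w} vw w-reaches = trans
    (cong (reaches k v ∨_) (any-intro (λ x → G v x ∧ reaches k x) (allFin M) (∈-allFin w) (cong₂ _∧_ vw w-reaches)))
    (∨-zeroʳ (reaches k v))

  walkLength : ∀ {u v} → Walk G u v → ℕ
  walkLength here       = 0
  walkLength (step _ p) = suc (walkLength p)

  reaches-walk : ∀ {v} (p : Walk G v r) → reaches (walkLength p) v ≡ true
  reaches-walk here        = dec-true (r Fin.≟ r) refl
  reaches-walk (step vw p) = reaches-step (walkLength p) (Equivalence.to T-≡ vw) (reaches-walk p)

  reaches-mono : ∀ {k k′ v} → k ≤ k′ → reaches k v ≡ true → reaches k′ v ≡ true
  reaches-mono {k} {k′} {v} k≤k′ with m≤n⇒∃[o]m+o≡n k≤k′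
  ... | j , refl = go j
    where
    go : ∀ j → reaches k v ≡ true → reaches (k + j) v ≡ true
    go zero    k-reaches = subst (λ i → reaches i v ≡ true) (sym (+-identityʳ k)) k-reaches
    go (suc j) k-reaches rewrite +-suc k j | go j k-reaches = refl

  private
    module Count (v : Fin M) = DownwardClosedCount (λ k → reaches k v ≟ᵇ false)
      (λ i≤j j-false → ¬-not λ i-true → true≢false (trans (sym (reaches-mono i≤j i-true)) j-false))

  dist : Fin M → ℕ
  dist v = Count.count v (upTo (walkLength (connected v r)))

  dist-reaches : ∀ v → reaches (dist v) v ≡ true
  dist-reaches v with reaches (dist v) v in eq
  ... | true  = refl
  ... | false with dist v <? walkLength (connected v r)
  ...   | yes d<ℓ = contradiction (Count.P⇒<count v 0 (walkLength (connected v r)) (dist v) eq d<ℓ) (<-irrefl refl)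
  ...   | no d≮ℓ  = contradiction (trans (sym eq) (reaches-mono (≮⇒≥ d≮ℓ) (reaches-walk (connected v r)))) λ ()

  dist-least : ∀ k {v} → reaches k v ≡ true → dist v ≤ k
  dist-least k {v} k-reaches with dist v in eq
  ... | zero  = z≤n
  ... | suc c with suc c ≤? k
  ...   | yes c<k = c<k
  ...   | no c≮k  = contradiction
    (trans (sym (Count.count≡suc⇒P v 0 (walkLength (connected v r)) c eq))
           (reaches-mono (≤-pred (≰⇒> c≮k)) k-reaches)) λ ()

  dist≡0⇒≡root : ∀ {v} → dist v ≡ 0 → v ≡ r
  dist≡0⇒≡root {v} d≡0 = =ᵇ≡true⇒≡ (subst (λ k → reaches k v ≡ true) d≡0 (dist-reaches v))

  dist-root : dist r ≡ 0
  dist-root = n≤0⇒n≡0 (dist-least 0 (dec-true (r Fin.≟ r) refl))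

  dist-adj : ∀ {v w} → G v w ≡ true → dist v ≤ suc (dist w)
  dist-adj {v} {w} vw = dist-least (suc (dist w)) (reaches-step (dist w) vw (dist-reaches w))

  parent : Fin M → Fin M
  parent v = choose (λ w → G v w ∧ reaches (pred (dist v)) w) v (allFin M)

  reaches-suc⁻ : ∀ k v → reaches (suc k) v ≡ true →
                 reaches k v ≡ true ⊎ any (λ w → G v w ∧ reaches k w) (allFin M) ≡ true
  reaches-suc⁻ k v k+1-reaches with reaches k v
  ... | true  = inj₁ refl
  ... | false = inj₂ k+1-reaches

  parent-spec : ∀ {v k} → dist v ≡ suc k → G v (parent v) ≡ true × dist (parent v) ≡ k
  parent-spec {v} {k} d≡ with reaches-suc⁻ k v (subst (λ i → reaches i v ≡ true) d≡ (dist-reaches v))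
  ... | inj₁ k-reaches      = contradiction (subst (_≤ k) d≡ (dist-least k k-reaches)) (<-irrefl refl)
  ... | inj₂ some-neighbour =
    v~p , ≤-antisym (dist-least k p-reaches) (≤-pred (subst (_≤ suc (dist p)) d≡ (dist-adj v~p)))
    where
    p = parent v
    chosen : (G v p ∧ reaches (pred (dist v)) p) ≡ true
    chosen = choose-sound (λ w → G v w ∧ reaches (pred (dist v)) w) v (allFin M)
      (subst (λ j → any (λ w → G v w ∧ reaches j w) (allFin M) ≡ true) (cong pred (sym d≡)) some-neighbour)
    v~p : G v p ≡ true
    v~p = ∧-conicalˡ _ _ chosen
    p-reaches : reaches k p ≡ true
    p-reaches = subst (λ j → reaches j p ≡ true) (cong pred d≡) (∧-conicalʳ _ _ chosen)

  dist≡suc⇒≢root : ∀ {v n} → dist v ≡ suc n → v ≢ r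
  dist≡suc⇒≢root d≡ refl = 0≢1+n (trans (sym dist-root) d≡)

  dist-parent : ∀ {v n} → dist v ≡ suc n → dist (parent v) ≡ n
  dist-parent d≡ = proj₂ (parent-spec d≡)

  dist-nonRoot : ∀ {v} → v ≢ r → Σ ℕ λ n → dist v ≡ suc n
  dist-nonRoot {v} v≢r with dist v in d≡
  ... | zero  = contradiction (dist≡0⇒≡root d≡) v≢r
  ... | suc n = n , refl

  parent-adj : ∀ v → v ≢ r → G v (parent v) ≡ true
  parent-adj v v≢r = proj₁ (parent-spec (proj₂ (dist-nonRoot v≢r)))

  ancestors : ℕ → Fin M → List (Fin M)
  ancestors zero    v = []
  ancestors (suc n) v = parent v ∷ ancestors n (parent v)

  ∈-path : ∀ {v n} → dist v ≡ n → ∀ {x} → x ∈ v ∷ ancestors n v → x ≡ v ⊎ dist x < n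
  ∈-path d≡ (here refl) = inj₁ refl
  ∈-path {n = suc n} d≡ (there x∈) with ∈-path (dist-parent d≡) x∈
  ... | inj₁ refl = inj₂ (≤-reflexive (cong suc (dist-parent d≡)))
  ... | inj₂ d<n  = inj₂ (m<n⇒m<1+n d<n)

  path-unique : ∀ {v n} → dist v ≡ n → Unique (v ∷ ancestors n v)
  path-unique {n = zero}  d≡ = [] ∷ []
  path-unique {v} {suc n} d≡ = All.tabulate (v∉ ∘ ∈-path (dist-parent d≡)) ∷ path-unique (dist-parent d≡)
    where
    v∉ : ∀ {x} → x ≡ parent v ⊎ dist x < n → v ≢ x
    v∉ (inj₁ x≡p) v≡x = <-irrefl
      (trans (sym (dist-parent d≡)) (trans (cong dist (sym x≡p)) (trans (cong dist (sym v≡x)) d≡))) (n<1+n n)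
    v∉ (inj₂ d<n) v≡x = <⇒≱ d<n (≤-trans (n≤1+n n) (≤-reflexive (sym (trans (cong dist (sym v≡x)) d≡))))

  path-linked : ∀ {v n} → dist v ≡ n → Linked (Adj G) (v ∷ ancestors n v)
  path-linked {n = zero}  d≡ = [-]
  path-linked {n = suc n} d≡ = Equivalence.from T-≡ (proj₁ (parent-spec d≡)) ∷ path-linked (dist-parent d≡)

  root∈path : ∀ {v n} → dist v ≡ n → r ∈ v ∷ ancestors n v
  root∈path {n = zero}  d≡ = here (sym (dist≡0⇒≡root d≡))
  root∈path {n = suc n} d≡ = there (root∈path (dist-parent d≡))

  pathToRoot : Fin M → List (Fin M)
  pathToRoot v = v ∷ ancestors (dist v) v

  adj⇒onPath : ∀ {u w} → G u w ≡ true → u ∉ pathToRoot w → w ∉ pathToRoot u → ⊥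
  adj⇒onPath {u} {w} uw u∉ w∉ = acyclic (meetingPaths⇒cycle Fin._≟_ (λ {a} {b} → Adj-sym a b)
    (path-unique refl) (path-unique refl) (path-linked refl) (path-linked refl)
    (Any.map (λ { refl → root∈path refl }) (root∈path refl)) (Equivalence.from T-≡ uw) u∉ w∉)
    where
    Adj-sym : ∀ a b → Adj G a b → Adj G b a
    Adj-sym a b rewrite symmetric a b = λ ab → ab

  private
    adj⇒≢ : ∀ {u w} → G u w ≡ true → u ≢ w
    adj⇒≢ {u} uw refl = true≢false (trans (sym uw) (irreflexive u))

  edge-down⇒parent : ∀ {u w} → G u w ≡ true → dist u ≡ suc (dist w) → u ≢ r × parent u ≡ w
  edge-down⇒parent {u} {w} uw d≡ with parent u Fin.≟ w
  ... | yes pu≡w = dist≡suc⇒≢root d≡ , pu≡w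
  ... | no pu≢w  = ⊥-elim (adj⇒onPath uw u∉ w∉)
    where
    u∉ : u ∉ pathToRoot w
    u∉ u∈ with ∈-path refl u∈
    ... | inj₁ u≡w = adj⇒≢ uw u≡w
    ... | inj₂ d<d = <-irrefl refl (≤-trans (s≤s (≤-trans (n≤1+n (dist w)) (≤-reflexive (sym d≡)))) d<d)
    w∉ : w ∉ pathToRoot u
    w∉ w∈ with subst (w ∈_) (cong (λ n → u ∷ ancestors n u) d≡) w∈
    ... | here w≡u = adj⇒≢ uw (sym w≡u)
    ... | there w∈′ with ∈-path (dist-parent d≡) w∈′
    ...   | inj₁ w≡pu = pu≢w (sym w≡pu)
    ...   | inj₂ d<d  = <-irrefl refl d<d

  edge⇒parent : ∀ u w → G u w ≡ true → (u ≢ r × parent u ≡ w) ⊎ (w ≢ r × parent w ≡ u)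
  edge⇒parent u w uw with <-cmp (dist u) (dist w)
  ... | tri> _ _ w<u = inj₁ (edge-down⇒parent uw (≤-antisym (dist-adj uw) w<u))
  ... | tri< u<w _ _ = inj₂ (edge-down⇒parent wu (≤-antisym (dist-adj wu) u<w))
    where wu = trans (symmetric w u) uw
  ... | tri≈ _ d≡ _ = ⊥-elim (adj⇒onPath uw u∉ w∉)
    where
    u∉ : u ∉ pathToRoot w
    u∉ u∈ with ∈-path refl u∈
    ... | inj₁ u≡w = adj⇒≢ uw u≡w
    ... | inj₂ d<d = <-irrefl d≡ d<d
    w∉ : w ∉ pathToRoot u
    w∉ w∈ with ∈-path refl w∈
    ... | inj₁ w≡u = adj⇒≢ uw (sym w≡u)
    ... | inj₂ d<d = <-irrefl (sym d≡) d<d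

  parent-asym : ∀ u w → u ≢ r → w ≢ r → parent u ≡ w → parent w ≢ u
  parent-asym u w u≢r w≢r refl pw≡u =
    <-asym (parent-closer u u≢r) (subst (λ x → dist x < dist w) pw≡u (parent-closer w w≢r))
    where
    parent-closer : ∀ v → v ≢ r → dist (parent v) < dist v
    parent-closer v v≢r with dist-nonRoot v≢r
    ... | n , d≡ = ≤-reflexive (trans (cong suc (dist-parent d≡)) (sym d≡))

  parentMap : ParentMap G
  parentMap = record
    { symmetric = symmetric ; irreflexive = irreflexive ; root = r ; parent = parent
    ; parent-adj = parent-adj ; edge⇒parent = edge⇒parent ; parent-asym = parent-asym }

-- The greedy tree

fullDeg≥1 : ∀ {D} → All (2 ≤_) D → ∀ i → 1 ≤ fullDeg D i
fullDeg≥1 []          i       = s≤s z≤n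
fullDeg≥1 (d≥2 ∷ _)   zero    = ≤-trans (s≤s z≤n) d≥2
fullDeg≥1 (_ ∷ D≥2)   (suc i) = fullDeg≥1 D≥2 i

fullDeg-suc : ∀ {D} → Linked _≥_ D → All (2 ≤_) D → ∀ i → fullDeg D (suc i) ≤ fullDeg D i
fullDeg-suc {[]}         _          _         i       = ≤-refl
fullDeg-suc {d ∷ []}     _          (d≥2 ∷ _) zero    = ≤-trans (s≤s z≤n) d≥2
fullDeg-suc {d ∷ _ ∷ _}  (d≥d′ ∷ _) _         zero    = d≥d′
fullDeg-suc {d ∷ D}      D↘         (_ ∷ D≥2) (suc i) = fullDeg-suc (Linked.tail D↘) D≥2 i

fullDeg-anti : ∀ {D} → Linked _≥_ D → All (2 ≤_) D → ∀ {i j} → i ≤ j → fullDeg D j ≤ fullDeg D i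
fullDeg-anti {D} D↘ D≥2 {i} i≤j with m≤n⇒∃[o]m+o≡n i≤j
... | o , refl = go o
  where
  go : ∀ o → fullDeg D (i + o) ≤ fullDeg D i
  go zero    = ≤-reflexive (cong (fullDeg D) (+-identityʳ i))
  go (suc o) = ≤-trans (≤-reflexive (cong (fullDeg D) (+-suc i o))) (≤-trans (fullDeg-suc D↘ D≥2 (i + o)) (go o))

prefixSum : List ℕ → ℕ → ℕ
prefixSum []      i       = i
prefixSum (d ∷ D) zero    = 0
prefixSum (d ∷ D) (suc i) = d + prefixSum D i

prefixSum-zero : ∀ D → prefixSum D 0 ≡ 0
prefixSum-zero []      = refl
prefixSum-zero (_ ∷ _) = refl

prefixSum-suc : ∀ D i → prefixSum D (suc i) ≡ prefixSum D i + fullDeg D i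
prefixSum-suc []      i       = +-comm 1 i
prefixSum-suc (d ∷ D) zero    = trans (cong (d +_) (prefixSum-zero D)) (+-comm d 0)
prefixSum-suc (d ∷ D) (suc i) = trans (cong (d +_) (prefixSum-suc D i)) (sym (+-assoc d _ _))

prefixSum-beyond : ∀ D j → prefixSum D (length D + j) ≡ sum D + j
prefixSum-beyond []      j = refl
prefixSum-beyond (d ∷ D) j = trans (cong (d +_) (prefixSum-beyond D j)) (sym (+-assoc d (sum D) j))

prefixSum≥2* : ∀ {D} → All (2 ≤_) D → ∀ i → i ≤ length D → 2 * i ≤ prefixSum D i
prefixSum≥2* _          zero    _         = z≤n
prefixSum≥2* {d ∷ D} (d≥2 ∷ D≥2) (suc i) (s≤s i≤k) =
  subst (_≤ d + prefixSum D i) (sym (*-suc 2 i)) (+-mono-≤ d≥2 (prefixSum≥2* D≥2 i i≤k))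

-- Vertices 0 … i have prefixSum D (i + 1) − i children, labelled 1, 2, ….
firstChild+i : ∀ {D} → All (2 ≤_) D → ∀ i → firstChild D (suc i) + i ≡ prefixSum D (suc i) + 1
firstChild+i {D} D≥2 zero    = trans (+-identityʳ _) (trans (+-comm 1 (fullDeg D 0))
  (cong (_+ 1) (sym (trans (prefixSum-suc D 0) (cong (_+ fullDeg D 0) (prefixSum-zero D))))))
firstChild+i {D} D≥2 (suc i) = begin
  (firstChild D (suc i) + (fullDeg D (suc i) ∸ 1)) + suc i
    ≡⟨ solve 3 (λ a b c → (a :+ b) :+ (con 1 :+ c) := (a :+ c) :+ (b :+ con 1)) refl
         (firstChild D (suc i)) (fullDeg D (suc i) ∸ 1) i ⟩
  (firstChild D (suc i) + i) + ((fullDeg D (suc i) ∸ 1) + 1)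
    ≡⟨ cong₂ _+_ (firstChild+i D≥2 i) (m∸n+n≡m (fullDeg≥1 D≥2 (suc i))) ⟩
  (prefixSum D (suc i) + 1) + fullDeg D (suc i)
    ≡⟨ solve 2 (λ a b → (a :+ con 1) :+ b := (a :+ b) :+ con 1) refl (prefixSum D (suc i)) (fullDeg D (suc i)) ⟩
  (prefixSum D (suc i) + fullDeg D (suc i)) + 1
    ≡⟨ cong (_+ 1) (prefixSum-suc D (suc i)) ⟨
  prefixSum D (suc (suc i)) + 1 ∎
  where open ≡-Reasoning

module GreedyLabels {D : List ℕ} (D↘ : Linked _≥_ D) (D≥2 : All (2 ≤_) D) where

  N : ℕ
  N = greedyN D

  private
    length≤sum : ∀ {E} → All (2 ≤_) E → length E ≤ sum E
    length≤sum []          = z≤n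
    length≤sum (e≥2 ∷ E≥2) = +-mono-≤ (≤-trans (s≤s z≤n) e≥2) (length≤sum E≥2)

  firstChild-beyond : ∀ i → length D ≤ suc i → firstChild D (suc i) ≡ N
  firstChild-beyond i k≤i+1 with m≤n⇒∃[o]m+o≡n k≤i+1
  ... | j , k+j≡ = +-cancelʳ-≡ (suc i) _ _ (begin
    firstChild D (suc i) + suc i    ≡⟨ +-suc _ i ⟩
    suc (firstChild D (suc i) + i)  ≡⟨ cong suc (firstChild+i D≥2 i) ⟩
    suc (prefixSum D (suc i) + 1)   ≡⟨ cong (λ n → suc (prefixSum D n + 1)) k+j≡ ⟨
    suc (prefixSum D (k + j) + 1)   ≡⟨ cong (λ n → suc (n + 1)) (prefixSum-beyond D j) ⟩
    suc (S + j + 1)                 ≡⟨ cong (λ n → suc (n + j + 1)) (m∸n+n≡m (length≤sum D≥2)) ⟨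
    suc ((S ∸ k) + k + j + 1)       ≡⟨ solve 3 (λ t k j → con 1 :+ (t :+ k :+ j :+ con 1) := (t :+ con 2) :+ (k :+ j))
                                         refl (S ∸ k) k j ⟩
    N + (k + j)                     ≡⟨ cong (N +_) k+j≡ ⟩
    N + suc i                       ∎)
    where
    open ≡-Reasoning
    k = length D
    S = sum D

  firstChild-after : ∀ i → i ≤ length D → suc i ≤ firstChild D i
  firstChild-after zero    _   = s≤s z≤n
  firstChild-after (suc i) i<k = +-cancelʳ-≤ i (suc (suc i)) (firstChild D (suc i)) (begin
    suc (suc i) + i            ≤⟨ n≤1+n _ ⟩
    suc (suc (suc i) + i)      ≡⟨ solve 1 (λ i → con 1 :+ (con 2 :+ i :+ i) := con 2 :* (con 1 :+ i) :+ con 1) refl i ⟩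
    2 * suc i + 1              ≤⟨ +-monoˡ-≤ 1 (prefixSum≥2* D≥2 (suc i) i<k) ⟩
    prefixSum D (suc i) + 1    ≡⟨ firstChild+i D≥2 i ⟨
    firstChild D (suc i) + i   ∎)
    where open ≤-Reasoning

  firstChild-mono : ∀ {i j} → i ≤ j → firstChild D i ≤ firstChild D j
  firstChild-mono {i} i≤j with m≤n⇒∃[o]m+o≡n i≤j
  ... | o , refl = go o
    where
    go : ∀ o → firstChild D i ≤ firstChild D (i + o)
    go zero    = ≤-reflexive (cong (firstChild D) (sym (+-identityʳ i)))
    go (suc o) = ≤-trans (go o) (≤-trans (m≤m+n _ (childCount D (i + o)))
                                          (≤-reflexive (cong (firstChild D) (sym (+-suc i o)))))

  firstChild-after-or-last : ∀ i → suc i ≤ firstChild D i ⊎ firstChild D i ≡ N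
  firstChild-after-or-last i with i ≤? length D
  ... | yes i≤k = inj₁ (firstChild-after i i≤k)
  firstChild-after-or-last zero    | no i≰k = contradiction z≤n i≰k
  firstChild-after-or-last (suc i) | no i≰k = inj₂ (firstChild-beyond i (<⇒≤ (≰⇒> i≰k)))

  firstChild≤N : ∀ i → firstChild D i ≤ N
  firstChild≤N i = ≤-trans (firstChild-mono (≤-trans (m≤n+m i (length D)) (n≤1+n _)))
    (≤-reflexive (firstChild-beyond (length D + i) (≤-trans (m≤m+n (length D) i) (n≤1+n _))))

  length≤N : length D ≤ N
  length≤N = ≤-trans (m+n≤o⇒m≤o∸n (length D) (begin
    length D + length D          ≡⟨ solve 1 (λ k → k :+ k := con 2 :* k) refl (length D) ⟩
    2 * length D                 ≤⟨ prefixSum≥2* D≥2 (length D) ≤-refl ⟩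
    prefixSum D (length D)       ≡⟨ cong (prefixSum D) (+-identityʳ (length D)) ⟨
    prefixSum D (length D + 0)   ≡⟨ trans (prefixSum-beyond D 0) (+-identityʳ (sum D)) ⟩
    sum D                        ∎)) (m≤m+n _ 2)
    where open ≤-Reasoning

  private
    module ParentCount (c : ℕ) =
      DownwardClosedCount (λ q → firstChild D q ≤? c) (λ q≤q′ → ≤-trans (firstChild-mono q≤q′))

  -- firstChild is monotone, so the labels q ∈ [1, c] with firstChild D q ≤ c are 1, …, (parent of c).
  parentLabel : ℕ → ℕ
  parentLabel c = ParentCount.count c (applyUpTo suc c)

  parentLabel≤ : ∀ c → parentLabel c ≤ c
  parentLabel≤ c = ≤-trans (length-filter (λ q → firstChild D q ≤? c) (applyUpTo suc c))
                           (≤-reflexive (length-applyUpTo suc c))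

  firstChild-parentLabel : ∀ {c} → 1 ≤ c → firstChild D (parentLabel c) ≤ c
  firstChild-parentLabel {c} 1≤c with parentLabel c in eq
  ... | zero  = 1≤c
  ... | suc q = ParentCount.count≡suc⇒P c 1 c q eq

  <firstChild-suc-parentLabel : ∀ {c} → c < N → c < firstChild D (suc (parentLabel c))
  <firstChild-suc-parentLabel {c} c<N with c <? firstChild D (suc (parentLabel c))
  ... | yes c< = c<
  ... | no c≮ with firstChild-after-or-last (suc (parentLabel c))
  ...   | inj₁ after = contradiction
    (ParentCount.P⇒<count c 1 c (parentLabel c) (≮⇒≥ c≮)
      (≤-trans (s≤s (n≤1+n _)) (≤-trans after (≮⇒≥ c≮))))
    (<-irrefl refl)
  ...   | inj₂ last = contradiction (≤-trans (≤-reflexive (sym last)) (≮⇒≥ c≮)) (<⇒≱ c<N)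

  parentLabel< : ∀ {c} → 1 ≤ c → c < N → parentLabel c < c
  parentLabel< {c} 1≤c c<N with firstChild-after-or-last (parentLabel c)
  ... | inj₁ after = ≤-trans after (firstChild-parentLabel 1≤c)
  ... | inj₂ last  = contradiction (≤-trans (≤-reflexive (sym last)) (firstChild-parentLabel 1≤c)) (<⇒≱ c<N)

  parentLabel-unique : ∀ {c q} → 1 ≤ c → c < N → firstChild D q ≤ c → c < firstChild D (suc q) → q ≡ parentLabel c
  parentLabel-unique {c} {q} 1≤c c<N fc≤c c<fc with <-cmp q (parentLabel c)
  ... | tri≈ _ q≡ _ = q≡
  ... | tri< q< _ _ = contradiction (≤-trans (firstChild-mono q<) (firstChild-parentLabel 1≤c)) (<⇒≱ c<fc)
  ... | tri> _ _ q> = contradiction (≤-trans (firstChild-mono q>) fc≤c) (<⇒≱ (<firstChild-suc-parentLabel c<N))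

  parentLabel-mono : ∀ {c c′} → c ≤ c′ → c′ < N → parentLabel c ≤ parentLabel c′
  parentLabel-mono {zero}  _ _ = z≤n
  parentLabel-mono {suc c} {c′} c≤c′ c′<N with parentLabel (suc c) ≤? parentLabel c′
  ... | yes ≤′ = ≤′
  ... | no ≰′  = contradiction (≤-trans (firstChild-mono (≰⇒> ≰′)) (≤-trans (firstChild-parentLabel (s≤s z≤n)) c≤c′))
                              (<⇒≱ (<firstChild-suc-parentLabel c′<N))

  isChild-elim : ∀ p c → isChild D p c ≡ true → firstChild D p ≤ c × c < firstChild D (suc p)
  isChild-elim p c eq with firstChild D p ≤ᵇ c in ≤c | c <ᵇ firstChild D (suc p) in c<
  ... | true | true = ≤ᵇ⇒≤ _ c (subst T (sym ≤c) _) , <ᵇ⇒< c _ (subst T (sym c<) _)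

  isChild-intro : ∀ p c → firstChild D p ≤ c → c < firstChild D (suc p) → isChild D p c ≡ true
  isChild-intro p c fc≤c c<fc = cong₂ _∧_ (Equivalence.to T-≡ (≤⇒≤ᵇ fc≤c)) (Equivalence.to T-≡ (<⇒<ᵇ c<fc))

tabulate-∘toℕ : ∀ {A : Set} {n} (f : ℕ → A) → tabulate {n = n} (f ∘ toℕ) ≡ applyUpTo f n
tabulate-∘toℕ {n = zero}  f = refl
tabulate-∘toℕ {n = suc n} f = cong (f 0 ∷_) (tabulate-∘toℕ {n = n} (f ∘ suc))

applyUpTo-fullDeg : ∀ D n → length D ≤ n → applyUpTo (fullDeg D) n ≡ D ++ replicate (n ∸ length D) 1
applyUpTo-fullDeg []      n       _         = go n
  where
  go : ∀ n → applyUpTo (λ _ → 1) n ≡ replicate n 1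
  go zero    = refl
  go (suc n) = cong (1 ∷_) (go n)
applyUpTo-fullDeg (d ∷ D) (suc n) (s≤s k≤n) = cong (d ∷_) (applyUpTo-fullDeg D n k≤n)

module GreedyTree {D : List ℕ} (D↘ : Linked _≥_ D) (D≥2 : All (2 ≤_) D) where
  open GreedyLabels D↘ D≥2 public

  private
    G = greedyTree D

    0<N : 0 < N
    0<N = ≤-trans (s≤s z≤n) (m≤n+m 2 (sum D ∸ length D))

  root : Fin N
  root = fromℕ< 0<N

  parent : Fin N → Fin N
  parent v = fromℕ< (≤-<-trans (parentLabel≤ (toℕ v)) (Fin.toℕ<n v))

  toℕ-root : toℕ root ≡ 0
  toℕ-root = Fin.toℕ-fromℕ< 0<N

  private
    toℕ-parent : ∀ v → toℕ (parent v) ≡ parentLabel (toℕ v)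
    toℕ-parent v = Fin.toℕ-fromℕ< _

    ≢root⇒≥1 : ∀ {v} → v ≢ root → 1 ≤ toℕ v
    ≢root⇒≥1 {v} v≢r with toℕ v in eq
    ... | zero  = contradiction (Fin.toℕ-injective (trans eq (sym toℕ-root))) v≢r
    ... | suc _ = s≤s z≤n

    ≥1⇒≢root : ∀ {v} → 1 ≤ toℕ v → v ≢ root
    ≥1⇒≢root 1≤v refl = <⇒≱ 1≤v (≤-reflexive toℕ-root)

  symmetric : SymmetricAdj G
  symmetric u w = ∨-comm (isChild D (toℕ u) (toℕ w)) (isChild D (toℕ w) (toℕ u))

  irreflexive : IrreflexiveAdj G
  irreflexive u with isChild D (toℕ u) (toℕ u) in eq
  ... | false = refl
  ... | true with firstChild-after-or-last (toℕ u)
  ...   | inj₁ after = contradiction (≤-trans after (proj₁ (isChild-elim (toℕ u) (toℕ u) eq))) (<-irrefl refl)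
  ...   | inj₂ last  = contradiction (≤-trans (≤-reflexive (sym last)) (proj₁ (isChild-elim (toℕ u) (toℕ u) eq)))
                                    (<⇒≱ (Fin.toℕ<n u))

  isChild-parent : ∀ v → v ≢ root → isChild D (toℕ (parent v)) (toℕ v) ≡ true
  isChild-parent v v≢r rewrite toℕ-parent v =
    isChild-intro (parentLabel (toℕ v)) (toℕ v)
      (firstChild-parentLabel (≢root⇒≥1 v≢r)) (<firstChild-suc-parentLabel (Fin.toℕ<n v))

  isChild⇒parent : ∀ u w → isChild D (toℕ u) (toℕ w) ≡ true → w ≢ root × parent w ≡ u
  isChild⇒parent u w eq = ≥1⇒≢root 1≤w , Fin.toℕ-injective (trans (toℕ-parent w)
    (sym (parentLabel-unique 1≤w (Fin.toℕ<n w) (proj₁ (isChild-elim (toℕ u) (toℕ w) eq))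
                                               (proj₂ (isChild-elim (toℕ u) (toℕ w) eq)))))
    where
    1≤w : 1 ≤ toℕ w
    1≤w = ≤-trans (firstChild-mono {0} {toℕ u} z≤n) (proj₁ (isChild-elim (toℕ u) (toℕ w) eq))

  parentMap : ParentMap G
  parentMap = record
    { symmetric   = symmetric
    ; irreflexive = irreflexive
    ; root        = root
    ; parent      = parent
    ; parent-adj  = λ v v≢r → trans (cong (isChild D (toℕ v) (toℕ (parent v)) ∨_) (isChild-parent v v≢r)) (∨-zeroʳ _)
    ; edge⇒parent = edge⇒parent
    ; parent-asym = λ u w u≢r w≢r pu≡w pw≡u → <-asym (parent< u u≢r pu≡w) (parent< w w≢r pw≡u)
    }
    where
    edge⇒parent : ∀ u w → G u w ≡ true → (u ≢ root × parent u ≡ w) ⊎ (w ≢ root × parent w ≡ u)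
    edge⇒parent u w uw with isChild D (toℕ u) (toℕ w) in u→w
    ... | true  = inj₂ (isChild⇒parent u w u→w)
    ... | false = inj₁ (isChild⇒parent w u uw)
    parent< : ∀ v {x} → v ≢ root → parent v ≡ x → toℕ x < toℕ v
    parent< v v≢r refl = subst (_< toℕ v) (sym (toℕ-parent v)) (parentLabel< (≢root⇒≥1 v≢r) (Fin.toℕ<n v))

  private
    module P = ParentMapProperties parentMap

  childOf≡isChild : ∀ v u → P.childOf v u ≡ isChild D (toℕ u) (toℕ v)
  childOf≡isChild v u with isChild D (toℕ u) (toℕ v) in u→v
  ... | true  = let v≢r , pv≡u = isChild⇒parent u v u→v in P.childOf-intro v≢r pv≡u
  ... | false = P.childOf-false {v} {u} λ (v≢r , pv≡u) → contradiction
    (trans (sym u→v) (subst (λ x → isChild D (toℕ x) (toℕ v) ≡ true) pv≡u (isChild-parent v v≢r))) λ ()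

  children≡childCount : ∀ u → P.children u ≡ childCount D (toℕ u)
  children≡childCount u = begin
    ∑[ v < N ] (if P.childOf v u then 1 else 0)
      ≡⟨ sum-cong-≗ {N} (λ v → cong (λ b → if b then 1 else 0) (childOf≡isChild v u)) ⟩
    ∑[ v < N ] (if isChild D p (toℕ v) then 1 else 0)
      ≡⟨ ∑-interval N (firstChild D p) (firstChild D (suc p)) (m≤m+n _ _) (firstChild≤N (suc p)) ⟩
    firstChild D (suc p) ∸ firstChild D p
      ≡⟨ m+n∸m≡n (firstChild D p) (childCount D p) ⟩
    childCount D p ∎
    where
    open ≡-Reasoning
    p = toℕ u

  deg-greedy : ∀ v → deg G v ≡ fullDeg D (toℕ v)
  deg-greedy v with v Fin.≟ root
  ... | yes refl = trans P.deg-root (trans (children≡childCount root)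
                     (trans (cong (childCount D) toℕ-root) (cong (fullDeg D) (sym toℕ-root))))
  ... | no v≢r   = trans (P.deg-nonRoot v≢r) (trans (cong suc (children≡childCount v)) (1+childCount (≢root⇒≥1 v≢r)))
    where
    1+childCount : ∀ {c} → 1 ≤ c → suc (childCount D c) ≡ fullDeg D c
    1+childCount {suc c} _ = trans (+-comm 1 _) (m∸n+n≡m (fullDeg≥1 D≥2 (suc c)))

  deg-root≥1 : 1 ≤ deg G root
  deg-root≥1 = subst (1 ≤_) (sym (trans (deg-greedy root) (cong (fullDeg D) toℕ-root))) (fullDeg≥1 D≥2 0)

  degrees-greedy : degrees G ≡ D ++ replicate (N ∸ length D) 1
  degrees-greedy = begin
    map (deg G) (allFin N)             ≡⟨ map-tabulate id (deg G) ⟩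
    tabulate (deg G)                   ≡⟨ tabulate-cong deg-greedy ⟩
    tabulate (fullDeg D ∘ toℕ)         ≡⟨ tabulate-∘toℕ (fullDeg D) ⟩
    applyUpTo (fullDeg D) N            ≡⟨ applyUpTo-fullDeg D N length≤N ⟩
    D ++ replicate (N ∸ length D) 1    ∎
    where open ≡-Reasoning
  private
    nonRoot↗ : Linked (λ a b → toℕ a ≤ toℕ b) P.nonRoot
    nonRoot↗ = Linked.filter⁺ (λ v → ¬? (v Fin.≟ root)) ≤-trans
      (Linked.AllPairs⇒Linked (AllPairs.tabulate⁺-< <⇒≤))

  childDegrees↘ : Linked _≥_ P.childDegrees
  childDegrees↘ = Linked.map⁺ (Linked.map (λ {a} {b} a≤b →
    subst₂ _≥_ (sym (deg-greedy a)) (sym (deg-greedy b)) (fullDeg-anti D↘ D≥2 a≤b)) nonRoot↗)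

  parentDegrees↘ : Linked _≥_ P.parentDegrees
  parentDegrees↘ = Linked.map⁺ (Linked.map (λ {a} {b} a≤b →
    subst₂ _≥_ (sym (deg-greedy (parent a))) (sym (deg-greedy (parent b)))
      (subst₂ (λ x y → fullDeg D y ≤ fullDeg D x) (sym (toℕ-parent a)) (sym (toℕ-parent b))
        (fullDeg-anti D↘ D≥2 (parentLabel-mono a≤b (Fin.toℕ<n b))))) nonRoot↗)

-- Degree sequences

↭-filter-≢-++-replicate : ∀ x xs → xs ↭ filter (λ y → ¬? (y ≟ x)) xs ++ replicate (length (filter (_≟ x) xs)) x
↭-filter-≢-++-replicate x []       = ↭-refl
↭-filter-≢-++-replicate x (y ∷ xs) with y ≟ x
... | yes refl rewrite filter-reject (λ y → ¬? (y ≟ x)) {xs = xs} (λ x≢x → x≢x refl)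
                     | filter-accept (_≟ x) {xs = xs} refl
  = ↭-trans (↭-prep x (↭-filter-≢-++-replicate x xs)) (↭-sym (shift x (filter (λ y → ¬? (y ≟ x)) xs) _))
... | no y≢x rewrite filter-accept (λ y → ¬? (y ≟ x)) {xs = xs} y≢x | filter-reject (_≟ x) {xs = xs} y≢x
  = ↭-prep y (↭-filter-≢-++-replicate x xs)

pendantCount : ∀ {M} → AdjMat M → ℕ
pendantCount G = length (filter (_≟ 1) (degrees G))

degrees-↭-HasDegSeq : ∀ {M} {G : AdjMat M} {D} → HasDegSeq G D → degrees G ↭ D ++ replicate (pendantCount G) 1
degrees-↭-HasDegSeq {G = G} G∼D = ↭-trans (↭-filter-≢-++-replicate 1 (degrees G)) (++⁺ʳ _ G∼D)

-- The handshake lemma for a tree with M = length D + p vertices: sum D + p = 2 (M − 1).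
pendants-handshake : ∀ {M} {G : AdjMat M} → ParentMap G → ∀ {D p} → degrees G ↭ D ++ replicate p 1 →
            p + 2 * length D ≡ sum D + 2
pendants-handshake {M} {G} P {D} {p} G∼ = +-cancelʳ-≡ p _ _ (begin
  (p + 2 * length D) + p    ≡⟨ solve 2 (λ p k → (p :+ con 2 :* k) :+ p := con 2 :* (k :+ p)) refl p (length D) ⟩
  2 * (length D + p)        ≡⟨ cong (2 *_) #vertices ⟨
  2 * M                     ≡⟨ ParentMapProperties.sum-degrees P ⟨
  sum (degrees G) + 2       ≡⟨ cong (_+ 2) degree-sum ⟩
  (sum D + p) + 2           ≡⟨ solve 3 (λ s p t → (s :+ p) :+ t := (s :+ t) :+ p) refl (sum D) p 2 ⟩
  (sum D + 2) + p           ∎)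
  where
  open ≡-Reasoning
  #vertices : M ≡ length D + p
  #vertices = begin
    M                                  ≡⟨ trans (length-map (deg G) (allFin M)) (length-tabulate id) ⟨
    length (degrees G)                 ≡⟨ ↭-length G∼ ⟩
    length (D ++ replicate p 1)        ≡⟨ length-++ D ⟩
    length D + length (replicate p 1)  ≡⟨ cong (length D +_) (length-replicate p) ⟩
    length D + p                       ∎
  sum-replicate-1 : ∀ n → sum (replicate n 1) ≡ n
  sum-replicate-1 zero    = refl
  sum-replicate-1 (suc n) = cong suc (sum-replicate-1 n)
  degree-sum : sum (degrees G) ≡ sum D + p
  degree-sum = trans (sum-↭ G∼) (trans (sum-++ D (replicate p 1)) (cong (sum D +_) (sum-replicate-1 p)))

sameDegree : ∀ {M N} {G : AdjMat M} {H : AdjMat N} → degrees G ↭ degrees H → ∀ v → Σ (Fin N) λ u → deg G v ≡ deg H u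
sameDegree G↭H v with ∈-map⁻ _ (∈-resp-↭ G↭H (∈-map⁺ _ (∈-allFin v)))
... | u , _ , v≡u = u , v≡u

module _ {D : List ℕ} (D↘ : Linked _≥_ D) (D≥2 : All (2 ≤_) D) where
  open GreedyTree D↘ D≥2

  degrees-greedy-↭ : ∀ {M} {T : AdjMat M} → IsTree T → HasDegSeq T D → degrees (greedyTree D) ↭ degrees T
  degrees-greedy-↭ {M} {T} tree T∼D =
    ↭-trans G∼ (subst (λ p → D ++ replicate p 1 ↭ degrees T) samePendants (↭-sym T∼))
    where
    T∼ : degrees T ↭ D ++ replicate (pendantCount T) 1
    T∼ = degrees-↭-HasDegSeq T∼D
    G∼ : degrees (greedyTree D) ↭ D ++ replicate (N ∸ length D) 1
    G∼ = ↭-reflexive degrees-greedy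
    samePendants : pendantCount T ≡ N ∸ length D
    samePendants = +-cancelʳ-≡ (2 * length D) (pendantCount T) (N ∸ length D) (trans
      (pendants-handshake (TreeParentMap.parentMap tree (fromℕ< (>-nonZero⁻¹ M {{proj₁ tree}}))) {D} T∼)
      (sym (pendants-handshake parentMap {D} G∼)))

mainTheorem1 : (D : List ℕ) → Linked (λ a b → b ≤ a) D → All (λ d → 2 ≤ d) D →
    Σ ℕ (λ M → Σ (AdjMat M) (λ T → IsTree T × HasDegSeq T D)) →
    (M : ℕ) (T : AdjMat M) → IsTree T → HasDegSeq T D →
    greedyTree D SO≤ T
mainTheorem1 D D↘ D≥2 _ M T tree T∼D = approx
  (sortedParentMap-≼√ parentMap (TreeParentMap.parentMap tree r) degrees↭ root≡r deg-root≥1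
                      childDegrees↘ parentDegrees↘)
  where
  open GreedyTree D↘ D≥2
  degrees↭ : degrees (greedyTree D) ↭ degrees T
  degrees↭ = degrees-greedy-↭ D↘ D≥2 tree T∼D
  r : Fin M
  r = proj₁ (sameDegree degrees↭ root)
  root≡r : deg (greedyTree D) root ≡ deg T r
  root≡r = proj₂ (sameDegree degrees↭ root)
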